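{- Let $t(n)=(-1)^{s_2(n)}$ ($s_2(n)$ the binary digit sum of $n$) and $T(n;x)=\sum_{m=0}^{n-1}t(m)x^m$. Let $\omega$ be a root of unity of exact odd order $r_0$, let $s_0$ be the multiplicative order of $2$ modulo $r_0$, and let $\langle 2\rangle$ be the subgroup of $(\mathbb{Z}/r_0\mathbb{Z})^\times$ generated by $2$. Let $q=|(\mathbb{Z}/r_0\mathbb{Z})^\times/\langle 2\rangle|$ and let $1,m_1,\ldots,m_{q-1}$ be representatives of the distinct cosets of $\langle2\rangle$ in $(\mathbb{Z}/r_0\mathbb{Z})^\times$. For $m$ coprime to $r_0$ let $\psi_m$ be the automorphism of $\mathbb{Q}(\omega)$ with $\psi_m(\omega)=\omega^m$. Then $$\Phi_{r_0}(1)=T(2^{s_0};\omega)\prod_{j=1}^{q-1}\psi_{m_j}\big(T(2^{s_0};\omega)\big),$$ where $\Phi_{r_0}$ is the $r_0$th cyclotomic polynomial.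
   Context: $\{t(n)\}$ is the $\pm1$-valued Thue--Morse sequence; the exact order of $\omega$ is the least $r_0\ge1$ with $\omega^{r_0}=1$. -}

module Defs where

open import Level using (Level)
open import Data.Nat as ℕ using (ℕ; zero; suc; _∸_; _<_; _≤_)
open import Data.Nat.DivMod using (_%_; _/_)
open import Data.Nat.Divisibility using (_∣?_)
open import Data.Nat.Coprimality using (Coprime)
open import Data.Integer as ℤ using (ℤ; +_; -[1+_])
open import Data.Integer.Divisibility using () renaming (_∣_ to _∣ℤ_)
open import Data.List using (List; []; _∷_; map; foldr; filter; length; replicate; reverse; zipWith; drop; _++_; applyUpTo)
open import Data.List.Relation.Unary.All using (All)
open import Data.List.Relation.Unary.Any using (Any)
open import Data.List.Relation.Unary.AllPairs using (AllPairs)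
open import Data.Product using (∃; _×_)
open import Relation.Nullary using (¬_; yes; no)
import Data.Sum
import Relation.Binary.PropositionalEquality
open import Algebra.Bundles using (CommutativeRing)
import Algebra.Bundles
import Algebra.Definitions.RawSemiring as RS

-- s₂ n, computed with fuel n (n / 2 < n for n ≥ 1, so fuel n suffices)
s₂-fuel : ℕ → ℕ → ℕ
s₂-fuel zero    n = 0
s₂-fuel (suc f) n = n % 2 ℕ.+ s₂-fuel f (n / 2)

s₂ : ℕ → ℕ
s₂ n = s₂-fuel n n

minusOnePow : ℕ → ℤ
minusOnePow zero    = + 1
minusOnePow (suc k) = ℤ.- minusOnePow k

t : ℕ → ℤ
t n = minusOnePow (s₂ n)

-- Integer polynomials, as coefficient lists with the HIGHEST degree first.
-- (A list [a_d, …, a_1, a_0] denotes a_d x^d + … + a_0.)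

Polyℤ : Set
Polyℤ = List ℤ

-- addition / multiplication on LOW-first lists
private
  addL : List ℤ → List ℤ → List ℤ
  addL []       q        = q
  addL (a ∷ p)  []       = a ∷ p
  addL (a ∷ p)  (b ∷ q)  = (a ℤ.+ b) ∷ addL p q

  mulL : List ℤ → List ℤ → List ℤ
  mulL []      q = []
  mulL (a ∷ p) q = addL (map (a ℤ.*_) q) (+ 0 ∷ mulL p q)

_*ₚ_ : Polyℤ → Polyℤ → Polyℤ
p *ₚ q = reverse (mulL (reverse p) (reverse q))

prodₚ : List Polyℤ → Polyℤ
prodₚ = foldr _*ₚ_ (+ 1 ∷ [])

-- Long division (quotient) of a high-first polynomial by a MONIC
-- high-first polynomial (leading coefficient 1), with fuel.
divMonic-fuel : ℕ → Polyℤ → Polyℤ → Polyℤ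
divMonic-fuel zero    p       d = []
divMonic-fuel (suc f) []      d = []
divMonic-fuel (suc f) (a ∷ p) [] = []
divMonic-fuel (suc f) (a ∷ p) (_ ∷ ds) with length ds ℕ.≤? length p
... | no  _ = []
... | yes _ =
  a ∷ divMonic-fuel f (zipWith (λ x y → x ℤ.- a ℤ.* y) p ds ++ drop (length ds) p) (+ 1 ∷ ds)

divMonic : Polyℤ → Polyℤ → Polyℤ
divMonic p d = divMonic-fuel (length p) p d

xⁿ-1 : ℕ → Polyℤ
xⁿ-1 zero    = []
xⁿ-1 (suc n) = + 1 ∷ (replicate n (+ 0) ++ (ℤ.- (+ 1)) ∷ [])

properDivisors : ℕ → List ℕ
properDivisors n = filter (_∣? n) (applyUpTo suc (n ∸ 1))

-- Cyclotomic polynomials via  x^n - 1 = ∏_{d ∣ n} Φ_d(x):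
-- Φ_n = (x^n - 1) / ∏_{d ∣ n, d < n} Φ_d   (exact division by a monic poly)
Φ-fuel : ℕ → ℕ → Polyℤ
Φ-fuel zero    n = + 1 ∷ []
Φ-fuel (suc f) n = divMonic (xⁿ-1 n) (prodₚ (map (Φ-fuel f) (properDivisors n)))

cyclotomic : ℕ → Polyℤ
cyclotomic n = Φ-fuel n n

evalℤ : Polyℤ → ℤ → ℤ
evalℤ p x = go p (+ 0)
  where
  go : Polyℤ → ℤ → ℤ
  go []      acc = acc
  go (a ∷ p) acc = go p (acc ℤ.* x ℤ.+ a)

infix 4 _≡_[mod_]
_≡_[mod_] : ℕ → ℕ → ℕ → Set
a ≡ b [mod n ] = (+ n) ∣ℤ ((+ a) ℤ.- (+ b))

IsOrderOf2Mod : ℕ → ℕ → Set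
IsOrderOf2Mod r s =
  1 ≤ s × (2 ℕ.^ s ≡ 1 [mod r ]) × (∀ k → 1 ≤ k → k < s → ¬ (2 ℕ.^ k ≡ 1 [mod r ]))

SameCoset : ℕ → ℕ → ℕ → Set
SameCoset r a b = ∃ λ k → a ≡ 2 ℕ.^ k ℕ.* b [mod r ]

CosetReps : ℕ → List ℕ → Set
CosetReps r reps =
  All (λ m → Coprime m r) reps ×
  AllPairs (λ a b → ¬ SameCoset r a b) reps ×
  (∀ a → Coprime a r → Any (SameCoset r a) reps)

module InRing {c ℓ : Level} (R : CommutativeRing c ℓ) where
  open CommutativeRing R
  open RS (Algebra.Bundles.Semiring.rawSemiring semiring) using (_^_) renaming (_×_ to _·_)

  ιℤ : ℤ → Carrier
  ιℤ (+ n)     = n · 1#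
  ιℤ -[1+ n ]  = - (suc n · 1#)

  T : ℕ → Carrier → Carrier
  T zero    x = 0#
  T (suc n) x = T n x + ιℤ (t n) * x ^ n

  prod : List Carrier → Carrier
  prod = foldr _*_ 1#

  ExactOrder : Carrier → ℕ → Set ℓ
  ExactOrder ω r = 1 ≤ r × (ω ^ r ≈ 1#) × (∀ k → 1 ≤ k → k < r → ¬ (ω ^ k ≈ 1#))

  IsCharZeroDomain : Set (c Level.⊔ ℓ)
  IsCharZeroDomain =
    ¬ (1# ≈ 0#) ×
    (∀ x y → x * y ≈ 0# → Data.Sum._⊎_ (x ≈ 0#) (y ≈ 0#)) ×
    (∀ n → ¬ (suc n · 1# ≈ 0#))

  ωpow : Carrier → ℕ → Carrier
  ωpow x m = x ^ m

Odd : ℕ → Set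
Odd n = ∃ λ k → n Relation.Binary.PropositionalEquality.≡ suc (2 ℕ.* k)

module Submission where

-- For ζ of exact order n in an integral domain, Φₙ(y) = ∏ (y − ζᵃ) over the units a modulo n,
-- by strong induction on n: the product of the Φₑ over the proper divisors e of n splits over
-- the ζᵇ with gcd b n > 1 (these are the ζ^(a·n/e) with a a unit modulo e), so dividing yⁿ − 1
-- by it leaves a remainder vanishing at all these distinct roots, hence zero, and a monic
-- quotient of degree φ(n) that vanishes at the remaining ζᵃ.
-- At y = 1 the units modulo r₀ are regrouped into the cosets {m·2ᵏ : k < s₀} of ⟨2⟩, and
-- each coset contributes ∏ₖ (1 − (ωᵐ)^(2ᵏ)) = T(2^s₀; ωᵐ), since T(2n; x) = (1 − x) T(n; x²).

open import Defs
open import Level using (Level; _⊔_)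
open import Data.Empty using (⊥-elim)
open import Data.Nat as ℕ using (ℕ; zero; suc; _≤_; _<_; z≤n; s≤s; _∸_)
import Data.Nat.Properties as ℕP
open import Data.Nat.Coprimality using (Coprime)
open import Data.Nat.DivMod using (_%_; _/_; m≡m%n+[m/n]*n)
open import Data.Integer as ℤ using (ℤ; +_; -[1+_]; _⊖_)
import Data.Integer.Properties as ℤP
open import Data.Sign as Sign using (Sign)
open import Data.List using (List; []; _∷_; length; map; reverse; foldl; replicate; _++_; zipWith; drop; concatMap; applyUpTo)
open import Data.List.Properties
  using (reverse-injective; length-++; unfold-reverse; reverse-involutive; length-replicate; length-map; map-++; map-∘; reverse-++; length-reverse)
open import Data.List.Membership.Propositional using (_∈_)
open import Data.List.Membership.Propositional.Properties.WithK using (unique∧set⇒bag)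
open import Data.List.Relation.Binary.BagAndSetEquality using (∼bag⇒↭)
open import Data.List.Relation.Binary.Disjoint.Propositional using (Disjoint)
open import Data.List.Relation.Binary.Permutation.Propositional using (_↭_; ↭⇒↭ₛ)
open import Data.List.Relation.Unary.All as All using (All)
import Data.List.Relation.Unary.All.Properties as All
open import Data.List.Relation.Unary.Any using (here; there)
open import Data.List.Relation.Unary.AllPairs using (AllPairs)
import Data.List.Relation.Unary.AllPairs.Properties as AllPairs
open import Data.List.Relation.Unary.Unique.Propositional using (Unique)
import Data.List.Relation.Unary.Unique.Propositional.Properties as Unique
open import Data.Maybe using (Maybe; just; nothing)
open import Data.Product using (∃; _×_; _,_; proj₁; proj₂)
open import Data.Sum using (_⊎_; inj₁; inj₂)
open import Function using (_∘_)
open import Function.Bundles using (mk⇔)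
open import Relation.Nullary using (¬_; yes; no)
open import Relation.Binary using (tri<; tri≈; tri>)
open import Relation.Binary.PropositionalEquality as ≡ using (_≡_; _≢_)
open import Algebra.Bundles using (CommutativeRing)
import Algebra.Bundles
import Algebra.Solver.Ring
import Algebra.Solver.Ring.AlmostCommutativeRing as ACR

module _ {a} {A : Set a} where

  open import Data.List.Relation.Unary.AllPairs using ([]; _∷_)

  unique∧⊆∧⊇⇒↭ : {xs ys : List A} → Unique xs → Unique ys →
                 (∀ {x} → x ∈ xs → x ∈ ys) → (∀ {x} → x ∈ ys → x ∈ xs) → xs ↭ ys
  unique∧⊆∧⊇⇒↭ xs! ys! xs⊆ys ys⊆xs = ∼bag⇒↭ (unique∧set⇒bag xs! ys! (mk⇔ xs⊆ys ys⊆xs))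

  unique⇒allPairs : ∀ {r} {R : A → A → Set r} {xs : List A} → Unique xs →
                    (∀ {x y} → x ∈ xs → y ∈ xs → x ≢ y → R x y) → AllPairs R xs
  unique⇒allPairs {xs = []}     []          R-on-xs = []
  unique⇒allPairs {xs = x ∷ xs} (x∉xs ∷ xs!) R-on-xs =
    All.tabulate (λ y∈xs → R-on-xs (here ≡.refl) (there y∈xs) (All.lookup x∉xs y∈xs)) ∷
    unique⇒allPairs xs! (λ x∈ y∈ → R-on-xs (there x∈) (there y∈))

module _ {a b} {A : Set a} {B : Set b} where

  concatMap-unique : (f : A → List B) {xs : List A} → All (λ x → Unique (f x)) xs →
                     AllPairs (λ x y → Disjoint (f x) (f y)) xs → Unique (concatMap f xs)
  concatMap-unique f fx! disjoint = Unique.concat⁺ (All.map⁺ fx!) (AllPairs.map⁺ disjoint)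

map-applyUpTo : ∀ {a b} {A : Set a} {B : Set b} (g : A → B) (f : ℕ → A) n → map g (applyUpTo f n) ≡ applyUpTo (g ∘ f) n
map-applyUpTo g f zero    = ≡.refl
map-applyUpTo g f (suc n) = ≡.cong (g (f 0) ∷_) (map-applyUpTo g (f ∘ suc) n)

module NumberTheory where

  open import Data.Nat using (_*_; _+_; _^_; NonZero)
  open import Data.Nat.DivMod
    using (m*[n/m]≡n; m*n/n≡m; m/n*n≡m; [m+kn]%n≡m%n; %-distribˡ-*; m%n<n; m<n⇒m%n≡m; m/n<m; m*n%n≡0; +-distrib-/-∣ʳ)
  open import Data.Nat.Divisibility using (_∣_; divides; _∣?_; n∣m*n; ∣-antisym; ∣-trans; ∣1⇒≡1; ∣n∣m%n⇒∣m; ∣m+n∣m⇒∣n; m∣m*n)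
  open import Data.Nat.Coprimality as Coprime using (coprime?; coprime-divisor; coprime-/gcd; gcd≡1⇒coprime)
  open import Data.Nat.GCD using (gcd; gcd[m,n]∣m; gcd[m,n]∣n; gcd[m,n]≢0)
  open import Data.Nat.Solver using (module +-*-Solver)
  open import Data.List using (upTo; filter)
  open import Data.List.Membership.Propositional using (find; lose)
  open import Data.List.Membership.Propositional.Properties
    using (∈-filter⁻; ∈-filter⁺; ∈-upTo⁻; ∈-upTo⁺; ∈-applyUpTo⁻; ∈-applyUpTo⁺; ∈-map⁻; ∈-map⁺; ∈-concatMap⁻; ∈-concatMap⁺; ∈-++⁻; ∈-++⁺ˡ; ∈-++⁺ʳ)
  open import Data.List.Properties using (length-upTo)
  open import Data.List.Relation.Binary.Permutation.Propositional.Properties using (↭-length)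
  open import Data.List.Relation.Unary.AllPairs as AllPairs using ([]; _∷_)
  open import Relation.Binary.PropositionalEquality using (refl; sym; trans; cong; cong₂; subst; subst₂; module ≡-Reasoning)

  units : ℕ → List ℕ
  units n = filter (λ a → coprime? a n) (upTo n)

  ∈units⁻ : ∀ n {a} → a ∈ units n → a < n × Coprime a n
  ∈units⁻ n {a} a∈ with ∈-filter⁻ (λ a → coprime? a n) {xs = upTo n} a∈
  ... | a∈upTo , coprime = ∈-upTo⁻ a∈upTo , coprime

  ∈units⁺ : ∀ {a n} → a < n → Coprime a n → a ∈ units n
  ∈units⁺ {a} {n} a<n coprime = ∈-filter⁺ (λ a → coprime? a n) (∈-upTo⁺ a<n) coprime

  units-unique : ∀ n → Unique (units n)
  units-unique n = Unique.filter⁺ (λ a → coprime? a n) (Unique.upTo⁺ n)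

  -- n / e, with the junk value 0 at e = 0 (never used: proper divisors are positive)
  cofactor : ℕ → ℕ → ℕ
  cofactor n zero    = 0
  cofactor n (suc e) = n / suc e

  record ProperDivisor (n e : ℕ) : Set where
    field
      positive   : 1 ≤ e
      <n         : e < n
      *-cofactor : e * cofactor n e ≡ n
      cofactor≥2 : 2 ≤ cofactor n e

  ∈properDivisors⁻ : ∀ n {e} → e ∈ properDivisors n → ProperDivisor n e
  ∈properDivisors⁻ n {e} e∈ with ∈-filter⁻ (_∣? n) {xs = applyUpTo suc (n ∸ 1)} e∈
  ... | e∈range , e∣n with ∈-applyUpTo⁻ suc e∈range
  ... | i , i<n-1 , refl = record
    { positive   = s≤s z≤n
    ; <n         = suc-< n i<n-1
    ; *-cofactor = e*[n/e]≡n
    ; cofactor≥2 = cofactor≥2 (n / suc i) e*[n/e]≡n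
    }
    where
    suc-< : ∀ n → i < n ∸ 1 → suc i < n
    suc-< (suc n) i<n-1 = s≤s i<n-1
    e*[n/e]≡n : suc i * (n / suc i) ≡ n
    e*[n/e]≡n = m*[n/m]≡n e∣n
    cofactor≥2 : ∀ d → suc i * d ≡ n → 2 ≤ d
    cofactor≥2 zero          eq = ⊥-elim (ℕP.<⇒≢ (ℕP.≤-trans (s≤s z≤n) (suc-< n i<n-1)) (trans (sym (ℕP.*-zeroʳ (suc i))) eq))
    cofactor≥2 (suc zero)    eq = ⊥-elim (ℕP.<⇒≢ (suc-< n i<n-1) (trans (sym (ℕP.*-identityʳ (suc i))) eq))
    cofactor≥2 (suc (suc d)) eq = s≤s (s≤s z≤n)

  ∈properDivisors⁺ : ∀ {e n} → 1 ≤ e → e < n → e ∣ n → e ∈ properDivisors n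
  ∈properDivisors⁺ {suc e} {suc n} (s≤s z≤n) (s≤s e<n) e∣n = ∈-filter⁺ (_∣? suc n) (∈-applyUpTo⁺ suc e<n) e∣n

  properDivisors-unique : ∀ n → Unique (properDivisors n)
  properDivisors-unique n = Unique.filter⁺ (_∣? n) (Unique.applyUpTo⁺₁ suc (n ∸ 1) (λ i<j _ → ℕP.<⇒≢ i<j ∘ ℕP.suc-injective))

  -- The b < n with gcd b n > 1, grouped by e = n / gcd b n: then b = a * (n / e) for a unit a mod e.
  nonUnits : ℕ → List ℕ
  nonUnits n = concatMap (λ e → map (_* cofactor n e) (units e)) (properDivisors n)

  ∈nonUnits⁻ : ∀ n {b} → b ∈ nonUnits n → b < n × ¬ Coprime b n
  ∈nonUnits⁻ n {b} b∈ with find (∈-concatMap⁻ (λ e → map (_* cofactor n e) (units e)) {xs = properDivisors n} b∈)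
  ... | e , e∈ , b∈block with ∈-map⁻ (_* cofactor n e) b∈block
  ... | a , a∈ , refl = a*d<n , λ coprime → ℕP.<⇒≢ cofactor≥2 (sym (coprime (n∣m*n a , d∣n)))
    where
    open ProperDivisor (∈properDivisors⁻ n e∈)
    d = cofactor n e
    a*d<n : a * d < n
    a*d<n = subst (a * d <_) *-cofactor (ℕP.*-monoˡ-< d {{ℕ.>-nonZero (ℕP.≤-trans (s≤s z≤n) cofactor≥2)}} (proj₁ (∈units⁻ e a∈)))
    d∣n : d ∣ n
    d∣n = divides e (sym *-cofactor)

  ∈nonUnits⁺ : ∀ {n b} → b < n → ¬ Coprime b n → b ∈ nonUnits n
  ∈nonUnits⁺ {n} {b} b<n ¬coprime =
    ∈-concatMap⁺ (λ e → map (_* cofactor n e) (units e)) {xs = properDivisors n} (lose e∈ b∈block)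
    where
    n≢0 : n ≢ 0
    n≢0 n≡0 = ℕP.<⇒≢ (ℕP.≤-trans (s≤s z≤n) b<n) (sym n≡0)
    g = gcd b n
    instance g-nonZero : NonZero g
    g-nonZero = ℕ.≢-nonZero (gcd[m,n]≢0 b n (inj₂ n≢0))
    g≥2 : 2 ≤ g
    g≥2 with g | gcd[m,n]≢0 b n (inj₂ n≢0) | ¬coprime ∘ gcd≡1⇒coprime {b} {n}
    ... | zero        | g≢0 | _       = ⊥-elim (g≢0 refl)
    ... | suc zero    | _   | g≢1     = ⊥-elim (g≢1 refl)
    ... | suc (suc _) | _   | _       = s≤s (s≤s z≤n)
    e = n / g
    a = b / g
    e*g≡n : e * g ≡ n
    e*g≡n = m/n*n≡m (gcd[m,n]∣n b n)
    a*g≡b : a * g ≡ b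
    a*g≡b = m/n*n≡m (gcd[m,n]∣m b n)
    e≢0 : e ≢ 0
    e≢0 e≡0 = n≢0 (trans (sym e*g≡n) (cong (_* g) e≡0))
    e∈ : e ∈ properDivisors n
    e∈ = ∈properDivisors⁺ (ℕP.n≢0⇒n>0 e≢0)
           (subst₂ _<_ (ℕP.*-identityʳ e) e*g≡n (ℕP.*-monoʳ-< e {{ℕ.≢-nonZero e≢0}} g≥2))
           (divides g (trans (sym e*g≡n) (ℕP.*-comm e g)))
    a∈ : a ∈ units e
    a∈ = ∈units⁺ (ℕP.*-cancelʳ-< g a e (subst₂ _<_ (sym a*g≡b) (sym e*g≡n) b<n)) (coprime-/gcd b n)
    cofactor≡g : ∀ e → e ≢ 0 → e * g ≡ n → cofactor n e ≡ g
    cofactor≡g zero    e≢0 _  = ⊥-elim (e≢0 refl)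
    cofactor≡g (suc e) _   eq = trans (cong (_/ suc e) (sym (trans (ℕP.*-comm g (suc e)) eq))) (m*n/n≡m g (suc e))
    b∈block : b ∈ map (_* cofactor n e) (units e)
    b∈block = subst (_∈ map (_* cofactor n e) (units e))
                    (trans (cong (a *_) (cofactor≡g e e≢0 e*g≡n)) a*g≡b)
                    (∈-map⁺ (_* cofactor n e) a∈)

  private
    nonUnit-determines-divisor : ∀ {n e e′ a a′} → ProperDivisor n e → ProperDivisor n e′ →
      Coprime a e → Coprime a′ e′ → a * cofactor n e ≡ a′ * cofactor n e′ → e ≡ e′
    nonUnit-determines-divisor {n} {e} {e′} {a} {a′} pd pd′ a⊥e a′⊥e′ ad≡a′d′ =
      ∣-antisym (coprime-divisor (Coprime.sym a⊥e) (divides a′ (sym a′e≡ae′)))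
                (coprime-divisor (Coprime.sym a′⊥e′) (divides a a′e≡ae′))
      where
      open ProperDivisor
      d = cofactor n e
      d′ = cofactor n e′
      instance n-nonZero : NonZero n
      n-nonZero = ℕ.>-nonZero (ℕP.≤-trans (s≤s z≤n) (<n pd))
      open +-*-Solver
      a′e≡ae′ : a′ * e ≡ a * e′
      a′e≡ae′ = ℕP.*-cancelʳ-≡ (a′ * e) (a * e′) n (begin
        a′ * e * n          ≡⟨ cong (a′ * e *_) (sym (*-cofactor pd′)) ⟩
        a′ * e * (e′ * d′)  ≡⟨ solve 4 (λ a e e′ d → a :* e :* (e′ :* d) := a :* d :* (e :* e′)) refl a′ e e′ d′ ⟩
        a′ * d′ * (e * e′)  ≡⟨ cong (_* (e * e′)) (sym ad≡a′d′) ⟩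
        a * d * (e * e′)    ≡⟨ solve 4 (λ a e e′ d → a :* d :* (e :* e′) := a :* e′ :* (e :* d)) refl a e e′ d ⟩
        a * e′ * (e * d)    ≡⟨ cong (a * e′ *_) (*-cofactor pd) ⟩
        a * e′ * n          ∎)
        where open ≡-Reasoning

  nonUnits-unique : ∀ n → Unique (nonUnits n)
  nonUnits-unique n = concatMap-unique block (All.tabulate block-unique)
                        (unique⇒allPairs (properDivisors-unique n) blocks-disjoint)
    where
    block : ℕ → List ℕ
    block e = map (_* cofactor n e) (units e)
    block-unique : ∀ {e} → e ∈ properDivisors n → Unique (block e)
    block-unique {e} e∈ = Unique.map⁺ (ℕP.*-cancelʳ-≡ _ _ (cofactor n e) {{nonZero}}) (units-unique e)
      where
      nonZero = ℕ.>-nonZero (ℕP.≤-trans (s≤s z≤n) (ProperDivisor.cofactor≥2 (∈properDivisors⁻ n e∈)))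
    blocks-disjoint : ∀ {e e′} → e ∈ properDivisors n → e′ ∈ properDivisors n → e ≢ e′ → Disjoint (block e) (block e′)
    blocks-disjoint {e} {e′} e∈ e′∈ e≢e′ (b∈ , b∈′) with ∈-map⁻ (_* cofactor n e) b∈ | ∈-map⁻ (_* cofactor n e′) b∈′
    ... | a , a∈ , refl | a′ , a′∈ , eq = e≢e′ (nonUnit-determines-divisor
            (∈properDivisors⁻ n e∈) (∈properDivisors⁻ n e′∈) (proj₂ (∈units⁻ e a∈)) (proj₂ (∈units⁻ e′ a′∈)) eq)

  nonUnits++units↭upTo : ∀ n → nonUnits n ++ units n ↭ upTo n
  nonUnits++units↭upTo n = unique∧⊆∧⊇⇒↭
    (Unique.++⁺ (nonUnits-unique n) (units-unique n)
       (λ (b∈ , b∈′) → proj₂ (∈nonUnits⁻ n b∈) (proj₂ (∈units⁻ n b∈′))))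
    (Unique.upTo⁺ n) ⊆ ⊇
    where
    ⊆ : ∀ {b} → b ∈ nonUnits n ++ units n → b ∈ upTo n
    ⊆ b∈ with ∈-++⁻ (nonUnits n) b∈
    ... | inj₁ b∈ = ∈-upTo⁺ (proj₁ (∈nonUnits⁻ n b∈))
    ... | inj₂ b∈ = ∈-upTo⁺ (proj₁ (∈units⁻ n b∈))
    ⊇ : ∀ {b} → b ∈ upTo n → b ∈ nonUnits n ++ units n
    ⊇ {b} b∈ with coprime? b n
    ... | yes coprime  = ∈-++⁺ʳ (nonUnits n) (∈units⁺ (∈-upTo⁻ b∈) coprime)
    ... | no ¬coprime = ∈-++⁺ˡ (∈nonUnits⁺ (∈-upTo⁻ b∈) ¬coprime)

  length-nonUnits+units : ∀ n → length (nonUnits n) + length (units n) ≡ n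
  length-nonUnits+units n = begin
    length (nonUnits n) + length (units n) ≡⟨ length-++ (nonUnits n) ⟨
    length (nonUnits n ++ units n)         ≡⟨ ↭-length (nonUnits++units↭upTo n) ⟩
    length (upTo n)                        ≡⟨ length-upTo n ⟩
    n                                      ∎
    where open ≡-Reasoning


  module Modulo (r : ℕ) {{_ : NonZero r}} where

    private
      ∣+a-+b∣≡ : ∀ a b → b ≤ a → ℤ.∣ ℤ.+ a ℤ.- ℤ.+ b ∣ ≡ a ∸ b
      ∣+a-+b∣≡ a b b≤a = trans (cong ℤ.∣_∣ (ℤP.[+m]-[+n]≡m⊖n a b)) (trans (ℤP.∣m⊖n∣≡∣n⊖m∣ a b) (ℤP.∣⊖∣-≤ b≤a))

      ∣+a-+b∣≡′ : ∀ a b → a ≤ b → ℤ.∣ ℤ.+ a ℤ.- ℤ.+ b ∣ ≡ b ∸ a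
      ∣+a-+b∣≡′ a b a≤b = trans (cong ℤ.∣_∣ (ℤP.[+m]-[+n]≡m⊖n a b)) (ℤP.∣⊖∣-≤ a≤b)

    ∣∸⇒%≡ : ∀ {a b} → b ≤ a → r ∣ a ∸ b → a % r ≡ b % r
    ∣∸⇒%≡ {a} {b} b≤a (divides k a∸b≡kr) = begin
      a % r                ≡⟨ cong (_% r) (sym (ℕP.m+[n∸m]≡n b≤a)) ⟩
      (b + (a ∸ b)) % r    ≡⟨ cong (λ x → (b + x) % r) a∸b≡kr ⟩
      (b + k * r) % r      ≡⟨ [m+kn]%n≡m%n b k r ⟩
      b % r                ∎
      where open ≡-Reasoning

    %≡⇒∣∸ : ∀ {a b} → a % r ≡ b % r → r ∣ a ∸ b
    %≡⇒∣∸ {a} {b} a%r≡b%r = divides (a / r ∸ b / r) (begin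
      a ∸ b                                      ≡⟨ cong₂ _∸_ (m≡m%n+[m/n]*n a r) (m≡m%n+[m/n]*n b r) ⟩
      (a % r + a / r * r) ∸ (b % r + b / r * r)  ≡⟨ cong (λ x → (x + a / r * r) ∸ (b % r + b / r * r)) a%r≡b%r ⟩
      (b % r + a / r * r) ∸ (b % r + b / r * r)  ≡⟨ ℕP.[m+n]∸[m+o]≡n∸o (b % r) (a / r * r) (b / r * r) ⟩
      a / r * r ∸ b / r * r                      ≡⟨ ℕP.*-distribʳ-∸ r (a / r) (b / r) ⟨
      (a / r ∸ b / r) * r                        ∎)
      where open ≡-Reasoning

    [mod]⇒%≡ : ∀ {a b} → a ≡ b [mod r ] → a % r ≡ b % r
    [mod]⇒%≡ {a} {b} r∣a-b with ℕP.≤-total b a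
    ... | inj₁ b≤a = ∣∸⇒%≡ b≤a (subst (r ∣_) (∣+a-+b∣≡ a b b≤a) r∣a-b)
    ... | inj₂ a≤b = sym (∣∸⇒%≡ a≤b (subst (r ∣_) (∣+a-+b∣≡′ a b a≤b) r∣a-b))

    %≡⇒[mod] : ∀ {a b} → a % r ≡ b % r → a ≡ b [mod r ]
    %≡⇒[mod] {a} {b} a%r≡b%r with ℕP.≤-total b a
    ... | inj₁ b≤a = subst (r ∣_) (sym (∣+a-+b∣≡ a b b≤a)) (%≡⇒∣∸ a%r≡b%r)
    ... | inj₂ a≤b = subst (r ∣_) (sym (∣+a-+b∣≡′ a b a≤b)) (%≡⇒∣∸ (sym a%r≡b%r))

    %≡-*ʳ : ∀ {a b} c → a % r ≡ b % r → (a * c) % r ≡ (b * c) % r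
    %≡-*ʳ {a} {b} c a%r≡b%r =
      trans (%-distribˡ-* a c r) (trans (cong (λ x → (x * (c % r)) % r) a%r≡b%r) (sym (%-distribˡ-* b c r)))

    %≡1⇒*-identityʳ : ∀ a {b} → b % r ≡ 1 % r → (a * b) % r ≡ a % r
    %≡1⇒*-identityʳ a {b} b%r≡1 = begin
      (a * b) % r  ≡⟨ cong (_% r) (ℕP.*-comm a b) ⟩
      (b * a) % r  ≡⟨ %≡-*ʳ a b%r≡1 ⟩
      (1 * a) % r  ≡⟨ cong (_% r) (ℕP.*-identityˡ a) ⟩
      a % r        ∎
      where open ≡-Reasoning

    %≡-*-cancelˡ : ∀ {m x y} → Coprime m r → (m * x) % r ≡ (m * y) % r → x % r ≡ y % r
    %≡-*-cancelˡ {m} {x} {y} m⊥r mx≡my with ℕP.≤-total y x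
    ... | inj₁ y≤x = ∣∸⇒%≡ y≤x (coprime-divisor (Coprime.sym m⊥r) (subst (r ∣_) (sym (ℕP.*-distribˡ-∸ m x y)) (%≡⇒∣∸ mx≡my)))
    ... | inj₂ x≤y = sym (∣∸⇒%≡ x≤y (coprime-divisor (Coprime.sym m⊥r) (subst (r ∣_) (sym (ℕP.*-distribˡ-∸ m y x)) (%≡⇒∣∸ (sym mx≡my)))))

    coprime-* : ∀ {a b} → Coprime a r → Coprime b r → Coprime (a * b) r
    coprime-* a⊥r b⊥r (d∣ab , d∣r) = b⊥r (coprime-divisor (λ (c∣d , c∣a) → a⊥r (c∣a , ∣-trans c∣d d∣r)) d∣ab , d∣r)

    coprime-^ : ∀ {a} k → Coprime a r → Coprime (a ^ k) r
    coprime-^ zero    a⊥r (d∣1 , _) = ∣1⇒≡1 d∣1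
    coprime-^ (suc k) a⊥r = coprime-* a⊥r (coprime-^ k a⊥r)

    coprime-% : ∀ {a} → Coprime a r → Coprime (a % r) r
    coprime-% {a} a⊥r (d∣a%r , d∣r) = a⊥r (∣n∣m%n⇒∣m d∣r d∣a%r , d∣r)


  module CosetEnumeration (r s : ℕ) {{_ : NonZero r}} (s-order : IsOrderOf2Mod r s)
                          (reps : List ℕ) (isReps : CosetReps r reps) where

    open Modulo r
    open +-*-Solver

    orbit : ℕ → List ℕ
    orbit m = applyUpTo (λ k → (m * 2 ^ k) % r) s

    cosetEnumeration : List ℕ
    cosetEnumeration = concatMap orbit reps

    private
      s≥1 : 1 ≤ s
      s≥1 = proj₁ s-order

      instance s-nonZero : NonZero s
      s-nonZero = ℕ.>-nonZero s≥1

      2^s≡1 : (2 ^ s) % r ≡ 1 % r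
      2^s≡1 = [mod]⇒%≡ (proj₁ (proj₂ s-order))

      2⊥r : Coprime 2 r
      2⊥r {d} (d∣2 , d∣r) =
        ∣1⇒≡1 (∣m+n∣m⇒∣n (subst (d ∣_) (sym (ℕP.m∸n+n≡m (ℕP.m^n>0 2 s))) (d∣2^s s s≥1))
                         (∣-trans d∣r (%≡⇒∣∸ 2^s≡1)))
        where
        d∣2^s : ∀ s → 1 ≤ s → d ∣ 2 ^ s
        d∣2^s (suc s) _ = ∣-trans d∣2 (m∣m*n (2 ^ s))

      rep-coprime : ∀ {m} → m ∈ reps → Coprime m r
      rep-coprime = All.lookup (proj₁ isReps)

      *2^k*2^[s∸k] : ∀ m {k} → k ≤ s → (m * 2 ^ k * 2 ^ (s ∸ k)) % r ≡ m % r
      *2^k*2^[s∸k] m {k} k≤s = begin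
        (m * 2 ^ k * 2 ^ (s ∸ k)) % r  ≡⟨ cong (_% r) (ℕP.*-assoc m (2 ^ k) _) ⟩
        (m * (2 ^ k * 2 ^ (s ∸ k))) % r ≡⟨ cong (λ x → (m * x) % r) (sym (ℕP.^-distribˡ-+-* 2 k (s ∸ k))) ⟩
        (m * 2 ^ (k + (s ∸ k))) % r     ≡⟨ cong (λ x → (m * 2 ^ x) % r) (ℕP.m+[n∸m]≡n k≤s) ⟩
        (m * 2 ^ s) % r                 ≡⟨ %≡1⇒*-identityʳ m 2^s≡1 ⟩
        m % r                           ∎
        where open ≡-Reasoning

      orbit-injective : ∀ {m i j} → Coprime m r → i < j → j < s → (m * 2 ^ i) % r ≢ (m * 2 ^ j) % r
      orbit-injective {m} {i} {j} m⊥r i<j j<s mi≡mj =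
        proj₂ (proj₂ s-order) (i + (s ∸ j)) 1≤i+[s∸j] i+[s∸j]<s (%≡⇒[mod] (%≡-*-cancelˡ m⊥r (begin
          (m * 2 ^ (i + (s ∸ j))) % r      ≡⟨ cong (λ x → (m * x) % r) (ℕP.^-distribˡ-+-* 2 i (s ∸ j)) ⟩
          (m * (2 ^ i * 2 ^ (s ∸ j))) % r  ≡⟨ cong (_% r) (sym (ℕP.*-assoc m (2 ^ i) _)) ⟩
          (m * 2 ^ i * 2 ^ (s ∸ j)) % r    ≡⟨ %≡-*ʳ (2 ^ (s ∸ j)) mi≡mj ⟩
          (m * 2 ^ j * 2 ^ (s ∸ j)) % r    ≡⟨ *2^k*2^[s∸k] m (ℕP.<⇒≤ j<s) ⟩
          m % r                            ≡⟨ cong (_% r) (sym (ℕP.*-identityʳ m)) ⟩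
          (m * 1) % r                      ∎)))
        where
        open ≡-Reasoning
        1≤i+[s∸j] : 1 ≤ i + (s ∸ j)
        1≤i+[s∸j] = ℕP.≤-trans (ℕP.m<n⇒0<n∸m j<s) (ℕP.m≤n+m (s ∸ j) i)
        i+[s∸j]<s : i + (s ∸ j) < s
        i+[s∸j]<s = ℕP.≤-trans (ℕP.+-monoˡ-< (s ∸ j) i<j) (ℕP.≤-reflexive (ℕP.m+[n∸m]≡n (ℕP.<⇒≤ j<s)))

      orbits-meet⇒SameCoset : ∀ {m m′ k k′} → k < s → (m * 2 ^ k) % r ≡ (m′ * 2 ^ k′) % r → SameCoset r m m′
      orbits-meet⇒SameCoset {m} {m′} {k} {k′} k<s mk≡m′k′ = k′ + (s ∸ k) , %≡⇒[mod] (begin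
        m % r                                ≡⟨ *2^k*2^[s∸k] m (ℕP.<⇒≤ k<s) ⟨
        (m * 2 ^ k * 2 ^ (s ∸ k)) % r        ≡⟨ %≡-*ʳ (2 ^ (s ∸ k)) mk≡m′k′ ⟩
        (m′ * 2 ^ k′ * 2 ^ (s ∸ k)) % r      ≡⟨ cong (_% r) (solve 3 (λ m a b → m :* a :* b := a :* b :* m) refl m′ (2 ^ k′) (2 ^ (s ∸ k))) ⟩
        (2 ^ k′ * 2 ^ (s ∸ k) * m′) % r      ≡⟨ cong (λ x → (x * m′) % r) (ℕP.^-distribˡ-+-* 2 k′ (s ∸ k)) ⟨
        (2 ^ (k′ + (s ∸ k)) * m′) % r        ∎)
        where open ≡-Reasoning

      *2^j≡*2^[j%s] : ∀ m j → (m * 2 ^ j) % r ≡ (m * 2 ^ (j % s)) % r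
      *2^j≡*2^[j%s] m j = begin
        (m * 2 ^ j) % r                              ≡⟨ cong (λ x → (m * 2 ^ x) % r) (m≡m%n+[m/n]*n j s) ⟩
        (m * 2 ^ (j % s + j / s * s)) % r            ≡⟨ cong (λ x → (m * x) % r) (ℕP.^-distribˡ-+-* 2 (j % s) (j / s * s)) ⟩
        (m * (2 ^ (j % s) * 2 ^ (j / s * s))) % r    ≡⟨ cong (_% r) (sym (ℕP.*-assoc m _ _)) ⟩
        (m * 2 ^ (j % s) * 2 ^ (j / s * s)) % r      ≡⟨ %≡1⇒*-identityʳ (m * 2 ^ (j % s)) (2^[q*s]≡1 (j / s)) ⟩
        (m * 2 ^ (j % s)) % r                        ∎
        where
        open ≡-Reasoning
        2^[q*s]≡1 : ∀ q → (2 ^ (q * s)) % r ≡ 1 % r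
        2^[q*s]≡1 zero    = refl
        2^[q*s]≡1 (suc q) = begin
          (2 ^ (s + q * s)) % r         ≡⟨ cong (_% r) (ℕP.^-distribˡ-+-* 2 s (q * s)) ⟩
          (2 ^ s * 2 ^ (q * s)) % r     ≡⟨ %≡1⇒*-identityʳ (2 ^ s) (2^[q*s]≡1 q) ⟩
          (2 ^ s) % r                   ≡⟨ 2^s≡1 ⟩
          1 % r                         ∎

      ∈cosetEnumeration⁻ : ∀ {b} → b ∈ cosetEnumeration → b ∈ units r
      ∈cosetEnumeration⁻ b∈ with find (∈-concatMap⁻ orbit {xs = reps} b∈)
      ... | m , m∈ , b∈orbit with ∈-applyUpTo⁻ _ b∈orbit
      ... | k , _ , refl = ∈units⁺ (m%n<n _ r) (coprime-% (coprime-* (rep-coprime m∈) (coprime-^ k 2⊥r)))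

      ∈cosetEnumeration⁺ : ∀ {b} → b ∈ units r → b ∈ cosetEnumeration
      ∈cosetEnumeration⁺ {b} b∈ with ∈units⁻ r b∈
      ... | b<r , b⊥r with find (proj₂ (proj₂ isReps) b b⊥r)
      ... | m , m∈ , j , b≡2^jm = ∈-concatMap⁺ orbit {xs = reps} (lose m∈ (subst (_∈ orbit m) (sym b≡) (∈-applyUpTo⁺ _ (m%n<n j s))))
        where
        b≡ : b ≡ (m * 2 ^ (j % s)) % r
        b≡ = begin
          b                      ≡⟨ m<n⇒m%n≡m b<r ⟨
          b % r                  ≡⟨ [mod]⇒%≡ b≡2^jm ⟩
          (2 ^ j * m) % r        ≡⟨ cong (_% r) (ℕP.*-comm (2 ^ j) m) ⟩
          (m * 2 ^ j) % r        ≡⟨ *2^j≡*2^[j%s] m j ⟩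
          (m * 2 ^ (j % s)) % r  ∎
          where open ≡-Reasoning

      cosetEnumeration-unique : Unique cosetEnumeration
      cosetEnumeration-unique = concatMap-unique orbit
        (All.tabulate (λ m∈ → Unique.applyUpTo⁺₁ _ s (orbit-injective (rep-coprime m∈))))
        (AllPairs.map orbits-disjoint (proj₁ (proj₂ isReps)))
        where
        orbits-disjoint : ∀ {m m′} → ¬ SameCoset r m m′ → Disjoint (orbit m) (orbit m′)
        orbits-disjoint ¬same (b∈ , b∈′) with ∈-applyUpTo⁻ _ b∈ | ∈-applyUpTo⁻ _ b∈′
        ... | k , k<s , refl | k′ , _ , eq = ¬same (orbits-meet⇒SameCoset {k′ = k′} k<s eq)

    cosetEnumeration↭units : cosetEnumeration ↭ units r
    cosetEnumeration↭units = unique∧⊆∧⊇⇒↭ cosetEnumeration-unique (units-unique r) ∈cosetEnumeration⁻ ∈cosetEnumeration⁺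

  private
    s₂-fuel-zero : ∀ f → s₂-fuel f 0 ≡ 0
    s₂-fuel-zero zero    = refl
    s₂-fuel-zero (suc f) = s₂-fuel-zero f

    n≤1+f⇒n/2≤f : ∀ n f → n ≤ suc f → n / 2 ≤ f
    n≤1+f⇒n/2≤f zero    f _           = z≤n
    n≤1+f⇒n/2≤f (suc n) f (s≤s n≤f) = ℕP.≤-trans (ℕP.≤-pred (m/n<m (suc n) 2 (s≤s (s≤s z≤n)))) n≤f

    s₂-fuel-irrelevant : ∀ f g n → n ≤ f → n ≤ g → s₂-fuel f n ≡ s₂-fuel g n
    s₂-fuel-irrelevant zero    zero    n     _   _   = refl
    s₂-fuel-irrelevant zero    (suc g) .zero z≤n _   = sym (s₂-fuel-zero (suc g))
    s₂-fuel-irrelevant (suc f) zero    .zero _   z≤n = s₂-fuel-zero (suc f)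
    s₂-fuel-irrelevant (suc f) (suc g) n     n≤f n≤g =
      cong (λ k → n % 2 + k) (s₂-fuel-irrelevant f g (n / 2) (n≤1+f⇒n/2≤f n f n≤f) (n≤1+f⇒n/2≤f n g n≤g))

    n≤n*2 : ∀ n → n ≤ n * 2
    n≤n*2 n = subst (n ≤_) (ℕP.*-comm 2 n) (ℕP.m≤m+n n (n + 0))

    s₂-double : ∀ m → s₂ (m * 2) ≡ s₂ m
    s₂-double zero    = refl
    s₂-double (suc m) = trans (cong₂ _+_ (m*n%n≡0 (suc m) 2) (cong (s₂-fuel (suc (m * 2))) (m*n/n≡m (suc m) 2)))
                              (s₂-fuel-irrelevant (suc (m * 2)) (suc m) (suc m) (s≤s (n≤n*2 m)) ℕP.≤-refl)

    s₂-double+1 : ∀ m → s₂ (suc (m * 2)) ≡ suc (s₂ m)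
    s₂-double+1 m = trans (cong₂ _+_ ([m+kn]%n≡m%n 1 m 2) (cong (s₂-fuel (m * 2)) [1+m*2]/2≡m))
                          (cong suc (s₂-fuel-irrelevant (m * 2) m m (n≤n*2 m) ℕP.≤-refl))
      where
      [1+m*2]/2≡m : (1 + m * 2) / 2 ≡ m
      [1+m*2]/2≡m = trans (+-distrib-/-∣ʳ 1 {m * 2} {2} (n∣m*n m)) (m*n/n≡m m 2)

  t-double : ∀ m → t (m * 2) ≡ t m
  t-double m = cong minusOnePow (s₂-double m)

  t-double+1 : ∀ m → t (suc (m * 2)) ≡ ℤ.- t m
  t-double+1 m = cong minusOnePow (s₂-double+1 m)

open NumberTheory


module IntegerEmbedding {c ℓ : Level} (R : CommutativeRing c ℓ) where

  open CommutativeRing R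
  open InRing R using (ιℤ)
  open import Algebra.Definitions.RawSemiring (Algebra.Bundles.Semiring.rawSemiring semiring) using () renaming (_×_ to _·_)
  open import Algebra.Properties.Ring ring using (-‿involutive; -‿distribˡ-*; -‿distribʳ-*; -0#≈0#)
  open import Algebra.Properties.AbelianGroup +-abelianGroup using (⁻¹-∙-comm)
  open import Algebra.Properties.Semiring.Mult semiring using (×-homo-+; ×1-homo-*)
  open import Relation.Binary.Reasoning.Setoid setoid

  ιℤ-⊖ : ∀ m n → ιℤ (m ⊖ n) ≈ m · 1# - n · 1#
  ιℤ-⊖ zero    zero    = sym (-‿inverseʳ 0#)
  ιℤ-⊖ (suc m) zero    = begin
    ιℤ (suc m ⊖ 0)     ≡⟨ ≡.cong ιℤ (ℤP.⊖-≥ {suc m} {0} z≤n) ⟩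
    suc m · 1#         ≈⟨ +-identityʳ _ ⟨
    suc m · 1# + 0#    ≈⟨ +-congˡ -0#≈0# ⟨
    suc m · 1# - 0#    ∎
  ιℤ-⊖ zero    (suc n) = begin
    ιℤ (0 ⊖ suc n)     ≡⟨ ≡.cong ιℤ (ℤP.⊖-< {0} {suc n} (s≤s z≤n)) ⟩
    - (suc n · 1#)     ≈⟨ +-identityˡ _ ⟨
    0# - suc n · 1#    ∎
  ιℤ-⊖ (suc m) (suc n) = begin
    ιℤ (suc m ⊖ suc n)                          ≡⟨ ≡.cong ιℤ (ℤP.[1+m]⊖[1+n]≡m⊖n m n) ⟩
    ιℤ (m ⊖ n)                                  ≈⟨ ιℤ-⊖ m n ⟩
    m · 1# - n · 1#                             ≈⟨ +-identityˡ _ ⟨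
    0# + (m · 1# - n · 1#)                      ≈⟨ +-congʳ (-‿inverseʳ 1#) ⟨
    (1# - 1#) + (m · 1# - n · 1#)               ≈⟨ +-assoc 1# (- 1#) _ ⟩
    1# + (- 1# + (m · 1# - n · 1#))             ≈⟨ +-congˡ (+-assoc (- 1#) _ _) ⟨
    1# + ((- 1# + m · 1#) - n · 1#)             ≈⟨ +-congˡ (+-congʳ (+-comm _ _)) ⟩
    1# + ((m · 1# - 1#) - n · 1#)               ≈⟨ +-congˡ (+-assoc _ _ _) ⟩
    1# + (m · 1# + (- 1# - n · 1#))             ≈⟨ +-assoc _ _ _ ⟨
    (1# + m · 1#) + (- 1# - n · 1#)             ≈⟨ +-congˡ (⁻¹-∙-comm 1# (n · 1#)) ⟩
    (1# + m · 1#) - (1# + n · 1#)               ∎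

  ιℤ-+ : ∀ a b → ιℤ (a ℤ.+ b) ≈ ιℤ a + ιℤ b
  ιℤ-+ -[1+ m ] -[1+ n ] = begin
    - (suc (suc (m ℕ.+ n)) · 1#)        ≈⟨ -‿cong (+-congˡ (×-homo-+ 1# (suc m) n)) ⟩
    - (1# + (suc m · 1# + n · 1#))      ≈⟨ -‿cong (+-assoc _ _ _) ⟨
    - ((1# + suc m · 1#) + n · 1#)      ≈⟨ -‿cong (+-congʳ (+-comm _ _)) ⟩
    - ((suc m · 1# + 1#) + n · 1#)      ≈⟨ -‿cong (+-assoc _ _ _) ⟩
    - (suc m · 1# + suc n · 1#)         ≈⟨ ⁻¹-∙-comm _ _ ⟨
    - (suc m · 1#) - suc n · 1#         ∎
  ιℤ-+ -[1+ m ] (+ n)    = trans (ιℤ-⊖ n (suc m)) (+-comm _ _)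
  ιℤ-+ (+ m)    -[1+ n ] = ιℤ-⊖ m (suc n)
  ιℤ-+ (+ m)    (+ n)    = ×-homo-+ 1# m n

  ιℤ-neg : ∀ a → ιℤ (ℤ.- a) ≈ - ιℤ a
  ιℤ-neg (+ zero)  = sym -0#≈0#
  ιℤ-neg (+ suc n) = refl
  ιℤ-neg -[1+ n ]  = sym (-‿involutive _)

  private
    signed : Sign → Carrier → Carrier
    signed Sign.+ x = x
    signed Sign.- x = - x

    signed-cong : ∀ s {x y} → x ≈ y → signed s x ≈ signed s y
    signed-cong Sign.+ x≈y = x≈y
    signed-cong Sign.- x≈y = -‿cong x≈y

    signed-* : ∀ s t x y → signed (s Sign.* t) (x * y) ≈ signed s x * signed t y
    signed-* Sign.+ Sign.+ x y = refl
    signed-* Sign.+ Sign.- x y = -‿distribʳ-* x y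
    signed-* Sign.- Sign.+ x y = -‿distribˡ-* x y
    signed-* Sign.- Sign.- x y = begin
      x * y          ≈⟨ *-congʳ (-‿involutive x) ⟨
      - - x * y      ≈⟨ -‿distribˡ-* (- x) y ⟨
      - (- x * y)    ≈⟨ -‿distribʳ-* (- x) y ⟩
      - x * - y      ∎

    ιℤ-◃ : ∀ s n → ιℤ (s ℤ.◃ n) ≈ signed s (n · 1#)
    ιℤ-◃ Sign.+ zero    = refl
    ιℤ-◃ Sign.- zero    = sym -0#≈0#
    ιℤ-◃ Sign.+ (suc n) = refl
    ιℤ-◃ Sign.- (suc n) = refl

    ιℤ-sign-abs : ∀ a → ιℤ a ≈ signed (ℤ.sign a) (ℤ.∣ a ∣ · 1#)
    ιℤ-sign-abs (+ n)    = refl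
    ιℤ-sign-abs -[1+ n ] = refl

  ιℤ-* : ∀ a b → ιℤ (a ℤ.* b) ≈ ιℤ a * ιℤ b
  ιℤ-* a b = begin
    ιℤ (a ℤ.* b)                                        ≈⟨ ιℤ-◃ (sa Sign.* sb) (ℤ.∣ a ∣ ℕ.* ℤ.∣ b ∣) ⟩
    signed (sa Sign.* sb) ((ℤ.∣ a ∣ ℕ.* ℤ.∣ b ∣) · 1#)   ≈⟨ signed-cong (sa Sign.* sb) (×1-homo-* ℤ.∣ a ∣ ℤ.∣ b ∣) ⟩
    signed (sa Sign.* sb) ((ℤ.∣ a ∣ · 1#) * (ℤ.∣ b ∣ · 1#)) ≈⟨ signed-* sa sb _ _ ⟩
    signed sa (ℤ.∣ a ∣ · 1#) * signed sb (ℤ.∣ b ∣ · 1#) ≈⟨ *-cong (ιℤ-sign-abs a) (ιℤ-sign-abs b) ⟨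
    ιℤ a * ιℤ b                                         ∎
    where
    sa = ℤ.sign a
    sb = ℤ.sign b

  ιℤ-1 : ιℤ (+ 1) ≈ 1#
  ιℤ-1 = +-identityʳ 1#

  ιℤ-homomorphism : ℤ.+-*-rawRing ACR.-Raw-AlmostCommutative⟶ ACR.fromCommutativeRing R
  ιℤ-homomorphism = record
    { ⟦_⟧ = ιℤ ; +-homo = ιℤ-+ ; *-homo = ιℤ-* ; -‿homo = ιℤ-neg ; 0-homo = refl ; 1-homo = ιℤ-1 }

  private
    ιℤ-≟ : ∀ a b → Maybe (ιℤ a ≈ ιℤ b)
    ιℤ-≟ a b with a ℤ.≟ b
    ... | yes ≡.refl = just refl
    ... | no _       = nothing

  module ℤ-Solver = Algebra.Solver.Ring ℤ.+-*-rawRing (ACR.fromCommutativeRing R) ιℤ-homomorphism ιℤ-≟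


addL : List ℤ → List ℤ → List ℤ
addL []      q       = q
addL (a ∷ p) []      = a ∷ p
addL (a ∷ p) (b ∷ q) = (a ℤ.+ b) ∷ addL p q

mulL : List ℤ → List ℤ → List ℤ
mulL []      q = []
mulL (a ∷ p) q = addL (map (a ℤ.*_) q) (+ 0 ∷ mulL p q)

private
  nil : List ℤ
  nil = []

  reverseOnto : List ℤ → List ℤ → List ℤ
  reverseOnto = foldl (λ ys x → x ∷ ys)

-- Defs keeps its copies of addL and mulL private; the metavariables below are
-- solved by unification with them, which makes their reductions available.
*ₚ-unfold : ∀ p q → p *ₚ q ≡ reverse (mulL (reverse p) (reverse q))
*ₚ-unfold p q = ≡.trans (≡.sym (solve-mulL p q)) (reverseOnto-mulL nil (reverse p) (reverse q))
  where
  reverseOnto-addLᴰ reverseOnto-mulLᴰ : List ℤ → List ℤ → List ℤ → List ℤ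
  reverseOnto-addLᴰ = _
  reverseOnto-mulLᴰ = _

  solve-addL : ∀ a q → reverseOnto-addLᴰ nil (map (a ℤ.*_) (reverse q)) (+ 0 ∷ []) ≡ (a ∷ []) *ₚ q
  solve-addL a q with map (a ℤ.*_) (reverse q) | + 0 ∷ []
  ... | u | v with nil
  ... | acc = ≡.refl

  solve-mulL : ∀ p q → reverseOnto-mulLᴰ nil (reverse p) (reverse q) ≡ p *ₚ q
  solve-mulL p q with reverse p | reverse q
  ... | P | Q with nil
  ... | acc = ≡.refl

  reverseOnto-addL : ∀ acc u v → reverseOnto-addLᴰ acc u v ≡ reverseOnto acc (addL u v)
  reverseOnto-addL acc []      v       = ≡.refl
  reverseOnto-addL acc (x ∷ u) []      = ≡.refl
  reverseOnto-addL acc (x ∷ u) (y ∷ v) = reverseOnto-addL ((x ℤ.+ y) ∷ acc) u v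

  reverseOnto-mulL : ∀ acc P Q → reverseOnto-mulLᴰ acc P Q ≡ reverseOnto acc (mulL P Q)
  reverseOnto-mulL acc []      Q = ≡.refl
  reverseOnto-mulL acc (a ∷ P) Q = ≡.trans (reverseOnto-addL acc (map (a ℤ.*_) Q) _)
    (≡.cong (λ M → reverseOnto acc (addL (map (a ℤ.*_) Q) (+ 0 ∷ M))) (reverse-injective (reverseOnto-mulL nil P Q)))

-- Reversed, a monic polynomial + 1 ∷ p ends in its leading coefficient: reverse p ++ + 1 ∷ [].
private
  addL-keeps-lastˡ : ∀ (p q : List ℤ) x → length q ≤ length p →
                 ∃ λ r → addL (p ++ x ∷ []) q ≡ r ++ x ∷ [] × length r ≡ length p
  addL-keeps-lastˡ []      []      x _         = [] , ≡.refl , ≡.refl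
  addL-keeps-lastˡ (a ∷ p) []      x _         = a ∷ p , ≡.refl , ≡.refl
  addL-keeps-lastˡ (a ∷ p) (b ∷ q) x (s≤s q≤p) with addL-keeps-lastˡ p q x q≤p
  ... | r , eq , len = (a ℤ.+ b) ∷ r , ≡.cong ((a ℤ.+ b) ∷_) eq , ≡.cong suc len

  addL-keeps-lastʳ : ∀ (p q : List ℤ) x → length p ≤ length q →
                 ∃ λ r → addL p (q ++ x ∷ []) ≡ r ++ x ∷ [] × length r ≡ length q
  addL-keeps-lastʳ []      q       x _         = q , ≡.refl , ≡.refl
  addL-keeps-lastʳ (a ∷ p) (b ∷ q) x (s≤s p≤q) with addL-keeps-lastʳ p q x p≤q
  ... | r , eq , len = (a ℤ.+ b) ∷ r , ≡.cong ((a ℤ.+ b) ∷_) eq , ≡.cong suc len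

  mulL-monic : ∀ (p q : List ℤ) → ∃ λ r → mulL (p ++ + 1 ∷ []) (q ++ + 1 ∷ []) ≡ r ++ + 1 ∷ [] × length r ≡ length p ℕ.+ length q
  mulL-monic [] [] = [] , ≡.refl , ≡.refl
  mulL-monic [] (b ∷ q) with addL-keeps-lastˡ (map (+ 1 ℤ.*_) (b ∷ q)) (+ 0 ∷ []) (+ 1) (s≤s z≤n)
  ... | r , eq , len = r , ≡.trans (≡.cong (λ u → addL u (+ 0 ∷ [])) (map-++ (+ 1 ℤ.*_) (b ∷ q) (+ 1 ∷ []))) eq
                         , ≡.trans len (length-map _ (b ∷ q))
  mulL-monic (a ∷ p) q with mulL-monic p q
  ... | r₀ , eq₀ , len₀ with addL-keeps-lastʳ (map (a ℤ.*_) (q ++ + 1 ∷ [])) (+ 0 ∷ r₀) (+ 1) short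
    where
    short : length (map (a ℤ.*_) (q ++ + 1 ∷ [])) ≤ suc (length r₀)
    short = ℕP.≤-trans (ℕP.≤-reflexive (≡.trans (length-map _ (q ++ + 1 ∷ [])) (≡.trans (length-++ q) (ℕP.+-comm (length q) 1))))
              (s≤s (ℕP.≤-trans (ℕP.m≤n+m (length q) (length p)) (ℕP.≤-reflexive (≡.sym len₀))))
  ... | r , eq , len = r , ≡.trans (≡.cong (λ u → addL (map (a ℤ.*_) (q ++ + 1 ∷ [])) (+ 0 ∷ u)) eq₀) eq , ≡.trans len (≡.cong suc len₀)

*ₚ-monic : ∀ p q → ∃ λ r → (+ 1 ∷ p) *ₚ (+ 1 ∷ q) ≡ + 1 ∷ r × length r ≡ length p ℕ.+ length q
*ₚ-monic p q with mulL-monic (reverse p) (reverse q)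
... | r , eq , len = reverse r , product≡ , ≡.trans (length-reverse r) (≡.trans len (≡.cong₂ ℕ._+_ (length-reverse p) (length-reverse q)))
  where
  open ≡.≡-Reasoning
  product≡ : (+ 1 ∷ p) *ₚ (+ 1 ∷ q) ≡ + 1 ∷ reverse r
  product≡ = begin
    (+ 1 ∷ p) *ₚ (+ 1 ∷ q)                                          ≡⟨ *ₚ-unfold (+ 1 ∷ p) (+ 1 ∷ q) ⟩
    reverse (mulL (reverse (+ 1 ∷ p)) (reverse (+ 1 ∷ q)))          ≡⟨ ≡.cong₂ (λ u v → reverse (mulL u v)) (unfold-reverse (+ 1) p) (unfold-reverse (+ 1) q) ⟩
    reverse (mulL (reverse p ++ + 1 ∷ []) (reverse q ++ + 1 ∷ []))  ≡⟨ ≡.cong reverse eq ⟩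
    reverse (r ++ + 1 ∷ [])                                         ≡⟨ reverse-++ r (+ 1 ∷ []) ⟩
    + 1 ∷ reverse r                                                 ∎


-- one step of long division by + 1 ∷ ds, as performed by divMonic-fuel
eliminate : ℤ → Polyℤ → Polyℤ → Polyℤ
eliminate a p ds = zipWith (λ x y → x ℤ.- a ℤ.* y) p ds ++ drop (length ds) p

length-eliminate : ∀ a p ds → length ds ≤ length p → length (eliminate a p ds) ≡ length p
length-eliminate a []      []       _         = ≡.refl
length-eliminate a (x ∷ p) []       _         = ≡.refl
length-eliminate a (x ∷ p) (d ∷ ds) (s≤s d≤p) = ≡.cong suc (length-eliminate a p ds d≤p)

module Evaluation {c ℓ : Level} (R : CommutativeRing c ℓ) where

  open CommutativeRing R
  open InRing R using (ιℤ)
  open IntegerEmbedding R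
  open ℤ-Solver using (solve; _:=_; _:+_; _:*_; _:-_)
  open import Algebra.Definitions.RawSemiring (Algebra.Bundles.Semiring.rawSemiring semiring) using (_^_)
  open import Algebra.Properties.Semiring.Exp semiring using (^-congˡ; ^-congʳ; ^-homo-*)
  open import Algebra.Properties.Ring ring using (-0#≈0#)
  open import Relation.Binary.Reasoning.Setoid setoid

  ⟦_⟧ : Polyℤ → Carrier → Carrier
  ⟦ []    ⟧ y = 0#
  ⟦ a ∷ p ⟧ y = ιℤ a * y ^ length p + ⟦ p ⟧ y

  ⟦⟧-cong : ∀ p {y z} → y ≈ z → ⟦ p ⟧ y ≈ ⟦ p ⟧ z
  ⟦⟧-cong []      y≈z = refl
  ⟦⟧-cong (a ∷ p) y≈z = +-cong (*-congˡ (^-congˡ (length p) y≈z)) (⟦⟧-cong p y≈z)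

  ⟦⟧-++ : ∀ p q y → ⟦ p ++ q ⟧ y ≈ ⟦ p ⟧ y * y ^ length q + ⟦ q ⟧ y
  ⟦⟧-++ []      q y = sym (trans (+-congʳ (zeroˡ _)) (+-identityˡ _))
  ⟦⟧-++ (a ∷ p) q y = begin
    ιℤ a * y ^ length (p ++ q) + ⟦ p ++ q ⟧ y
      ≈⟨ +-cong (*-congˡ (trans (^-congʳ y (length-++ p)) (^-homo-* y (length p) (length q)))) (⟦⟧-++ p q y) ⟩
    ιℤ a * (y ^ length p * y ^ length q) + (⟦ p ⟧ y * y ^ length q + ⟦ q ⟧ y)
      ≈⟨ solve 5 (λ a u v e f → a :* (u :* v) :+ (e :* v :+ f) := (a :* u :+ e) :* v :+ f) refl (ιℤ a) (y ^ length p) (y ^ length q) (⟦ p ⟧ y) (⟦ q ⟧ y) ⟩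
    (ιℤ a * y ^ length p + ⟦ p ⟧ y) * y ^ length q + ⟦ q ⟧ y ∎

  ⟦_⟧ˡ : List ℤ → Carrier → Carrier
  ⟦ []    ⟧ˡ y = 0#
  ⟦ a ∷ p ⟧ˡ y = ιℤ a + y * ⟦ p ⟧ˡ y

  ⟦reverse⟧ : ∀ p y → ⟦ reverse p ⟧ y ≈ ⟦ p ⟧ˡ y
  ⟦reverse⟧ []      y = refl
  ⟦reverse⟧ (a ∷ p) y = begin
    ⟦ reverse (a ∷ p) ⟧ y                       ≡⟨ ≡.cong (λ u → ⟦ u ⟧ y) (unfold-reverse a p) ⟩
    ⟦ reverse p ++ a ∷ [] ⟧ y                   ≈⟨ ⟦⟧-++ (reverse p) (a ∷ []) y ⟩
    ⟦ reverse p ⟧ y * (y * 1#) + (ιℤ a * 1# + 0#) ≈⟨ +-cong (*-cong (⟦reverse⟧ p y) (*-identityʳ y)) (trans (+-identityʳ _) (*-identityʳ _)) ⟩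
    ⟦ p ⟧ˡ y * y + ιℤ a                          ≈⟨ trans (+-comm _ _) (+-congˡ (*-comm _ _)) ⟩
    ιℤ a + y * ⟦ p ⟧ˡ y                          ∎

  ⟦⟧ˡ-addL : ∀ p q y → ⟦ addL p q ⟧ˡ y ≈ ⟦ p ⟧ˡ y + ⟦ q ⟧ˡ y
  ⟦⟧ˡ-addL []      q       y = sym (+-identityˡ _)
  ⟦⟧ˡ-addL (a ∷ p) []      y = sym (+-identityʳ _)
  ⟦⟧ˡ-addL (a ∷ p) (b ∷ q) y = begin
    ιℤ (a ℤ.+ b) + y * ⟦ addL p q ⟧ˡ y        ≈⟨ +-cong (ιℤ-+ a b) (*-congˡ (⟦⟧ˡ-addL p q y)) ⟩
    (ιℤ a + ιℤ b) + y * (⟦ p ⟧ˡ y + ⟦ q ⟧ˡ y)  ≈⟨ solve 5 (λ a b y u v → (a :+ b) :+ y :* (u :+ v) := (a :+ y :* u) :+ (b :+ y :* v)) refl (ιℤ a) (ιℤ b) y (⟦ p ⟧ˡ y) (⟦ q ⟧ˡ y) ⟩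
    (ιℤ a + y * ⟦ p ⟧ˡ y) + (ιℤ b + y * ⟦ q ⟧ˡ y) ∎

  ⟦⟧ˡ-scale : ∀ a q y → ⟦ map (a ℤ.*_) q ⟧ˡ y ≈ ιℤ a * ⟦ q ⟧ˡ y
  ⟦⟧ˡ-scale a []      y = sym (zeroʳ _)
  ⟦⟧ˡ-scale a (b ∷ q) y = begin
    ιℤ (a ℤ.* b) + y * ⟦ map (a ℤ.*_) q ⟧ˡ y  ≈⟨ +-cong (ιℤ-* a b) (*-congˡ (⟦⟧ˡ-scale a q y)) ⟩
    ιℤ a * ιℤ b + y * (ιℤ a * ⟦ q ⟧ˡ y)       ≈⟨ solve 4 (λ a b y u → a :* b :+ y :* (a :* u) := a :* (b :+ y :* u)) refl (ιℤ a) (ιℤ b) y (⟦ q ⟧ˡ y) ⟩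
    ιℤ a * (ιℤ b + y * ⟦ q ⟧ˡ y)               ∎

  ⟦⟧ˡ-mulL : ∀ p q y → ⟦ mulL p q ⟧ˡ y ≈ ⟦ p ⟧ˡ y * ⟦ q ⟧ˡ y
  ⟦⟧ˡ-mulL []      q y = sym (zeroˡ _)
  ⟦⟧ˡ-mulL (a ∷ p) q y = begin
    ⟦ addL (map (a ℤ.*_) q) (+ 0 ∷ mulL p q) ⟧ˡ y        ≈⟨ ⟦⟧ˡ-addL (map (a ℤ.*_) q) (+ 0 ∷ mulL p q) y ⟩
    ⟦ map (a ℤ.*_) q ⟧ˡ y + (0# + y * ⟦ mulL p q ⟧ˡ y)   ≈⟨ +-cong (⟦⟧ˡ-scale a q y) (trans (+-identityˡ _) (*-congˡ (⟦⟧ˡ-mulL p q y))) ⟩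
    ιℤ a * ⟦ q ⟧ˡ y + y * (⟦ p ⟧ˡ y * ⟦ q ⟧ˡ y)          ≈⟨ solve 4 (λ a w y u → a :* w :+ y :* (u :* w) := (a :+ y :* u) :* w) refl (ιℤ a) (⟦ q ⟧ˡ y) y (⟦ p ⟧ˡ y) ⟩
    (ιℤ a + y * ⟦ p ⟧ˡ y) * ⟦ q ⟧ˡ y                      ∎

  ⟦⟧-*ₚ : ∀ p q y → ⟦ p *ₚ q ⟧ y ≈ ⟦ p ⟧ y * ⟦ q ⟧ y
  ⟦⟧-*ₚ p q y = begin
    ⟦ p *ₚ q ⟧ y                                 ≡⟨ ≡.cong (λ u → ⟦ u ⟧ y) (*ₚ-unfold p q) ⟩
    ⟦ reverse (mulL (reverse p) (reverse q)) ⟧ y ≈⟨ ⟦reverse⟧ (mulL (reverse p) (reverse q)) y ⟩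
    ⟦ mulL (reverse p) (reverse q) ⟧ˡ y          ≈⟨ ⟦⟧ˡ-mulL (reverse p) (reverse q) y ⟩
    ⟦ reverse p ⟧ˡ y * ⟦ reverse q ⟧ˡ y          ≈⟨ *-cong (⟦reverse⟧² p) (⟦reverse⟧² q) ⟩
    ⟦ p ⟧ y * ⟦ q ⟧ y                            ∎
    where
    ⟦reverse⟧² : ∀ p → ⟦ reverse p ⟧ˡ y ≈ ⟦ p ⟧ y
    ⟦reverse⟧² p = trans (sym (⟦reverse⟧ (reverse p) y)) (reflexive (≡.cong (λ u → ⟦ u ⟧ y) (reverse-involutive p)))

  -- evalℤ runs Horner's scheme in a where-bound accumulator loop, reached here as in *ₚ-unfold
  ιℤ-evalℤ : ∀ p x → ιℤ (evalℤ p x) ≈ ⟦ p ⟧ (ιℤ x)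
  ιℤ-evalℤ []      x = refl
  ιℤ-evalℤ (a ∷ q) x = begin
    ιℤ (evalℤ (a ∷ q) x)                              ≡⟨ ≡.cong ιℤ (≡.sym (solve-horner a q x)) ⟩
    ιℤ (horner (a ∷ q) q (+ 0 ℤ.* x ℤ.+ a) x)         ≈⟨ ιℤ-horner (a ∷ q) q (+ 0 ℤ.* x ℤ.+ a) x ⟩
    ιℤ (+ 0 ℤ.* x ℤ.+ a) * ιℤ x ^ length q + ⟦ q ⟧ (ιℤ x) ≈⟨ +-congʳ (*-congʳ (trans (ιℤ-+ (+ 0 ℤ.* x) a) (+-identityˡ _))) ⟩
    ιℤ a * ιℤ x ^ length q + ⟦ q ⟧ (ιℤ x)             ∎
    where
    horner : List ℤ → List ℤ → ℤ → ℤ → ℤ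
    horner = _
    solve-horner : ∀ a q x → horner (a ∷ q) q (+ 0 ℤ.* x ℤ.+ a) x ≡ evalℤ (a ∷ q) x
    solve-horner a q x with a ∷ q | + 0 ℤ.* x ℤ.+ a
    ... | p | acc = ≡.refl
    ιℤ-horner : ∀ p q acc x → ιℤ (horner p q acc x) ≈ ιℤ acc * ιℤ x ^ length q + ⟦ q ⟧ (ιℤ x)
    ιℤ-horner p []      acc x = sym (trans (+-identityʳ _) (*-identityʳ _))
    ιℤ-horner p (b ∷ q) acc x = begin
      ιℤ (horner p q (acc ℤ.* x ℤ.+ b) x)                              ≈⟨ ιℤ-horner p q (acc ℤ.* x ℤ.+ b) x ⟩
      ιℤ (acc ℤ.* x ℤ.+ b) * ιℤ x ^ length q + ⟦ q ⟧ (ιℤ x)             ≈⟨ +-congʳ (*-congʳ (trans (ιℤ-+ (acc ℤ.* x) b) (+-congʳ (ιℤ-* acc x)))) ⟩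
      (ιℤ acc * ιℤ x + ιℤ b) * ιℤ x ^ length q + ⟦ q ⟧ (ιℤ x)           ≈⟨ solve 5 (λ a x b u e → (a :* x :+ b) :* u :+ e := a :* (x :* u) :+ (b :* u :+ e)) refl (ιℤ acc) (ιℤ x) (ιℤ b) (ιℤ x ^ length q) (⟦ q ⟧ (ιℤ x)) ⟩
      ιℤ acc * (ιℤ x * ιℤ x ^ length q) + (ιℤ b * ιℤ x ^ length q + ⟦ q ⟧ (ιℤ x)) ∎

  ⟦xⁿ-1⟧ : ∀ n y → ⟦ xⁿ-1 (suc n) ⟧ y ≈ y ^ suc n - 1#
  ⟦xⁿ-1⟧ n y = begin
    ιℤ (+ 1) * y ^ length tail + ⟦ tail ⟧ y
      ≈⟨ +-cong (*-cong ιℤ-1 (^-congʳ y length-tail)) (⟦⟧-++ (replicate n (+ 0)) (ℤ.- (+ 1) ∷ []) y) ⟩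
    1# * y ^ suc n + (⟦ replicate n (+ 0) ⟧ y * y ^ 1 + (- (1# + 0#) * 1# + 0#))
      ≈⟨ +-cong (*-identityˡ _) (+-cong (trans (*-congʳ (⟦zeros⟧ n)) (zeroˡ _)) (trans (+-identityʳ _) (trans (*-identityʳ _) (-‿cong (+-identityʳ _))))) ⟩
    y ^ suc n + (0# + - 1#)
      ≈⟨ +-congˡ (+-identityˡ _) ⟩
    y ^ suc n - 1# ∎
    where
    tail = replicate n (+ 0) ++ ℤ.- (+ 1) ∷ []
    length-tail : length tail ≡ suc n
    length-tail = ≡.trans (length-++ (replicate n (+ 0))) (≡.trans (≡.cong (ℕ._+ 1) (length-replicate n)) (ℕP.+-comm n 1))
    ⟦zeros⟧ : ∀ n → ⟦ replicate n (+ 0) ⟧ y ≈ 0#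
    ⟦zeros⟧ zero    = refl
    ⟦zeros⟧ (suc n) = trans (+-cong (zeroˡ _) (⟦zeros⟧ n)) (+-identityˡ _)

  ⟦eliminate⟧ : ∀ a p ds y → length ds ≤ length p →
                ⟦ eliminate a p ds ⟧ y ≈ ⟦ p ⟧ y - ιℤ a * y ^ (length p ∸ length ds) * ⟦ ds ⟧ y
  ⟦eliminate⟧ a []      []       y _ = sym (trans (+-congˡ (trans (-‿cong (zeroʳ _)) -0#≈0#)) (+-identityʳ _))
  ⟦eliminate⟧ a (x ∷ p) []       y _ = sym (trans (+-congˡ (trans (-‿cong (zeroʳ _)) -0#≈0#)) (+-identityʳ _))
  ⟦eliminate⟧ a (x ∷ p) (d ∷ ds) y (s≤s ds≤p) = begin
    ιℤ (x ℤ.- a ℤ.* d) * y ^ length (eliminate a p ds) + ⟦ eliminate a p ds ⟧ y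
      ≈⟨ +-cong (*-cong ιℤ-x-ad (trans (^-congʳ y (length-eliminate a p ds ds≤p)) y^|p|)) (⟦eliminate⟧ a p ds y ds≤p) ⟩
    (ιℤ x - ιℤ a * ιℤ d) * (y ^ K * y ^ length ds) + (⟦ p ⟧ y - ιℤ a * y ^ K * ⟦ ds ⟧ y)
      ≈⟨ solve 7 (λ x a d u v e f → (x :- a :* d) :* (u :* v) :+ (e :- a :* u :* f) := (x :* (u :* v) :+ e) :- a :* u :* (d :* v :+ f))
                refl (ιℤ x) (ιℤ a) (ιℤ d) (y ^ K) (y ^ length ds) (⟦ p ⟧ y) (⟦ ds ⟧ y) ⟩
    (ιℤ x * (y ^ K * y ^ length ds) + ⟦ p ⟧ y) - ιℤ a * y ^ K * (ιℤ d * y ^ length ds + ⟦ ds ⟧ y)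
      ≈⟨ +-congʳ (+-congʳ (*-congˡ (sym y^|p|))) ⟩
    (ιℤ x * y ^ length p + ⟦ p ⟧ y) - ιℤ a * y ^ K * (ιℤ d * y ^ length ds + ⟦ ds ⟧ y) ∎
    where
    K = length p ∸ length ds
    y^|p| : y ^ length p ≈ y ^ K * y ^ length ds
    y^|p| = trans (^-congʳ y (≡.sym (ℕP.m∸n+n≡m ds≤p))) (^-homo-* y K (length ds))
    ιℤ-x-ad : ιℤ (x ℤ.- a ℤ.* d) ≈ ιℤ x - ιℤ a * ιℤ d
    ιℤ-x-ad = trans (ιℤ-+ x (ℤ.- (a ℤ.* d))) (+-congˡ (trans (ιℤ-neg (a ℤ.* d)) (-‿cong (ιℤ-* a d))))

  record DivisionWithRemainder (p ds q : Polyℤ) : Set (c ⊔ ℓ) where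
    field
      length-quotient  : length q ≡ length p ∸ length ds
      remainder        : Polyℤ
      length-remainder : length remainder ≤ length ds
      identity         : ∀ y → ⟦ p ⟧ y ≈ ⟦ q ⟧ y * ⟦ + 1 ∷ ds ⟧ y + ⟦ remainder ⟧ y

  divMonic-fuel-division : ∀ f p ds → length p ∸ length ds ≤ f → DivisionWithRemainder p ds (divMonic-fuel f p (+ 1 ∷ ds))
  divMonic-fuel-division zero p ds p≤ds = record
    { length-quotient = ≡.sym (ℕP.n≤0⇒n≡0 p≤ds) ; remainder = p
    ; length-remainder = ℕP.m∸n≡0⇒m≤n (ℕP.n≤0⇒n≡0 p≤ds) ; identity = λ y → sym (trans (+-congʳ (zeroˡ _)) (+-identityˡ _)) }
  divMonic-fuel-division (suc f) [] ds _ = record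
    { length-quotient = ≡.sym (ℕP.0∸n≡0 (length ds)) ; remainder = []
    ; length-remainder = z≤n ; identity = λ y → sym (trans (+-congʳ (zeroˡ _)) (+-identityˡ _)) }
  divMonic-fuel-division (suc f) (a ∷ p) ds fuel with length ds ℕ.≤? length p
  ... | no ds≰p = record
    { length-quotient = ≡.sym (ℕP.m≤n⇒m∸n≡0 (ℕP.≰⇒> ds≰p)) ; remainder = a ∷ p
    ; length-remainder = ℕP.≰⇒> ds≰p ; identity = λ y → sym (trans (+-congʳ (zeroˡ _)) (+-identityˡ _)) }
  ... | yes ds≤p = record
    { length-quotient = ≡.trans (≡.cong suc length-q′) (≡.sym (ℕP.+-∸-assoc 1 ds≤p))
    ; remainder = remainder
    ; length-remainder = length-remainder
    ; identity = identity′ }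
    where
    p′ = eliminate a p ds
    fuel′ : length p′ ∸ length ds ≤ f
    fuel′ = ℕP.≤-trans (ℕP.≤-reflexive (≡.cong (_∸ length ds) (length-eliminate a p ds ds≤p)))
              (ℕP.≤-pred (ℕP.≤-trans (ℕP.≤-reflexive (≡.sym (ℕP.+-∸-assoc 1 ds≤p))) fuel))
    open DivisionWithRemainder (divMonic-fuel-division f p′ ds fuel′)
    q′ = divMonic-fuel f p′ (+ 1 ∷ ds)
    K = length p ∸ length ds
    length-q′ : length q′ ≡ K
    length-q′ = ≡.trans length-quotient (≡.cong (_∸ length ds) (length-eliminate a p ds ds≤p))
    identity′ : ∀ y → ιℤ a * y ^ length p + ⟦ p ⟧ y ≈ (ιℤ a * y ^ length q′ + ⟦ q′ ⟧ y) * ⟦ + 1 ∷ ds ⟧ y + ⟦ remainder ⟧ y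
    identity′ y = begin
      ιℤ a * y ^ length p + ⟦ p ⟧ y
        ≈⟨ +-cong (*-congˡ (trans (^-congʳ y (≡.sym (ℕP.m∸n+n≡m ds≤p))) (^-homo-* y K (length ds)))) ⟦p⟧ ⟩
      ιℤ a * (y ^ K * y ^ length ds) + ((⟦ q′ ⟧ y * (ιℤ (+ 1) * y ^ length ds + ⟦ ds ⟧ y) + ⟦ remainder ⟧ y) + ιℤ a * y ^ K * ⟦ ds ⟧ y)
        ≈⟨ +-congʳ (*-congˡ (*-congˡ (sym (trans (*-congʳ ιℤ-1) (*-identityˡ _))))) ⟩
      ιℤ a * (y ^ K * (ιℤ (+ 1) * y ^ length ds)) + ((⟦ q′ ⟧ y * (ιℤ (+ 1) * y ^ length ds + ⟦ ds ⟧ y) + ⟦ remainder ⟧ y) + ιℤ a * y ^ K * ⟦ ds ⟧ y)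
        ≈⟨ solve 7 (λ a u o v e q r → a :* (u :* (o :* v)) :+ ((q :* (o :* v :+ e) :+ r) :+ a :* u :* e) := (a :* u :+ q) :* (o :* v :+ e) :+ r)
                  refl (ιℤ a) (y ^ K) (ιℤ (+ 1)) (y ^ length ds) (⟦ ds ⟧ y) (⟦ q′ ⟧ y) (⟦ remainder ⟧ y) ⟩
      (ιℤ a * y ^ K + ⟦ q′ ⟧ y) * ⟦ + 1 ∷ ds ⟧ y + ⟦ remainder ⟧ y
        ≈⟨ +-congʳ (*-congʳ (+-congʳ (*-congˡ (^-congʳ y (≡.sym length-q′))))) ⟩
      (ιℤ a * y ^ length q′ + ⟦ q′ ⟧ y) * ⟦ + 1 ∷ ds ⟧ y + ⟦ remainder ⟧ y ∎
      where
      ⟦p⟧ : ⟦ p ⟧ y ≈ (⟦ q′ ⟧ y * ⟦ + 1 ∷ ds ⟧ y + ⟦ remainder ⟧ y) + ιℤ a * y ^ K * ⟦ ds ⟧ y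
      ⟦p⟧ = begin
        ⟦ p ⟧ y                                             ≈⟨ sym (trans (+-congʳ (⟦eliminate⟧ a p ds y ds≤p)) (trans (+-assoc _ _ _) (trans (+-congˡ (-‿inverseˡ _)) (+-identityʳ _)))) ⟩
        ⟦ p′ ⟧ y + ιℤ a * y ^ K * ⟦ ds ⟧ y                   ≈⟨ +-congʳ (identity y) ⟩
        (⟦ q′ ⟧ y * ⟦ + 1 ∷ ds ⟧ y + ⟦ remainder ⟧ y) + ιℤ a * y ^ K * ⟦ ds ⟧ y ∎

  divMonic-fuel-head : ∀ f a p h ds → length ds ≤ length p → ∃ λ q → divMonic-fuel (suc f) (a ∷ p) (h ∷ ds) ≡ a ∷ q
  divMonic-fuel-head f a p h ds ds≤p with length ds ℕ.≤? length p
  ... | yes _   = _ , ≡.refl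
  ... | no ds≰p = ⊥-elim (ds≰p ds≤p)


module Products {c ℓ : Level} (R : CommutativeRing c ℓ) where

  open CommutativeRing R
  open InRing R using (prod)
  open import Relation.Binary.Reasoning.Setoid setoid

  prod-++ : ∀ xs ys → prod (xs ++ ys) ≈ prod xs * prod ys
  prod-++ []       ys = sym (*-identityˡ _)
  prod-++ (x ∷ xs) ys = trans (*-congˡ (prod-++ xs ys)) (sym (*-assoc _ _ _))

  prod-map-cong : ∀ {a} {A : Set a} {f g : A → Carrier} xs → (∀ {x} → x ∈ xs → f x ≈ g x) → prod (map f xs) ≈ prod (map g xs)
  prod-map-cong []       f≈g = refl
  prod-map-cong (x ∷ xs) f≈g = *-cong (f≈g (here ≡.refl)) (prod-map-cong xs (f≈g ∘ there))

  prod-applyUpTo-cong : ∀ {f g : ℕ → Carrier} n → (∀ k → f k ≈ g k) → prod (applyUpTo f n) ≈ prod (applyUpTo g n)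
  prod-applyUpTo-cong zero    f≈g = refl
  prod-applyUpTo-cong (suc n) f≈g = *-cong (f≈g 0) (prod-applyUpTo-cong n (λ k → f≈g (suc k)))

  prod-concatMap : ∀ {a b} {A : Set a} {B : Set b} (f : B → Carrier) (g : A → List B) xs →
                   prod (map f (concatMap g xs)) ≈ prod (map (λ x → prod (map f (g x))) xs)
  prod-concatMap f g []       = refl
  prod-concatMap f g (x ∷ xs) = begin
    prod (map f (g x ++ concatMap g xs))                ≡⟨ ≡.cong prod (map-++ f (g x) (concatMap g xs)) ⟩
    prod (map f (g x) ++ map f (concatMap g xs))        ≈⟨ prod-++ (map f (g x)) _ ⟩
    prod (map f (g x)) * prod (map f (concatMap g xs))  ≈⟨ *-congˡ (prod-concatMap f g xs) ⟩
    prod (map f (g x)) * prod (map (λ x → prod (map f (g x))) xs) ∎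

  prod-zero : ∀ {a} {A : Set a} (f : A → Carrier) {x} xs → x ∈ xs → f x ≈ 0# → prod (map f xs) ≈ 0#
  prod-zero f (y ∷ xs) (here ≡.refl) fx≈0 = trans (*-congʳ fx≈0) (zeroˡ _)
  prod-zero f (y ∷ xs) (there x∈)    fx≈0 = trans (*-congˡ (prod-zero f xs x∈ fx≈0)) (zeroʳ _)

  prod-↭ : ∀ {a} {A : Set a} (f : A → Carrier) {xs ys} → xs ↭ ys → prod (map f xs) ≈ prod (map f ys)
  prod-↭ f xs↭ys = foldr-commMonoid *-isCommutativeMonoid (map⁺ setoid (λ { ≡.refl → refl }) (↭⇒↭ₛ xs↭ys))
    where
    open import Data.List.Relation.Binary.Permutation.Setoid.Properties setoid using (foldr-commMonoid)
    open import Data.List.Relation.Binary.Permutation.Setoid.Properties (≡.setoid _) using (map⁺)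


IsIntegralDomain : ∀ {c ℓ} → CommutativeRing c ℓ → Set (c ⊔ ℓ)
IsIntegralDomain R = ¬ 1# ≈ 0# × (∀ x y → x * y ≈ 0# → x ≈ 0# ⊎ y ≈ 0#)
  where open CommutativeRing R

module Roots {c ℓ : Level} (R : CommutativeRing c ℓ) (isIntegralDomain : IsIntegralDomain R) where

  open CommutativeRing R

  private
    1≉0 : ¬ 1# ≈ 0#
    1≉0 = proj₁ isIntegralDomain
    domain : ∀ x y → x * y ≈ 0# → x ≈ 0# ⊎ y ≈ 0#
    domain = proj₂ isIntegralDomain

  open import Data.List.Relation.Unary.All using ([]; _∷_)
  open import Data.List.Relation.Unary.AllPairs as AllPairs using ([]; _∷_)

  open InRing R using (ιℤ; prod; ExactOrder)
  open Evaluation R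
  open Products R
  open IntegerEmbedding R using (module ℤ-Solver)
  open ℤ-Solver using (solve; _:=_; _:+_; _:*_; _:-_)
  open import Algebra.Definitions.RawSemiring (Algebra.Bundles.Semiring.rawSemiring semiring) using (_^_)
  open import Algebra.Properties.Semiring.Exp semiring using (^-congʳ)
  open import Relation.Binary.Reasoning.Setoid setoid

  eval : List Carrier → Carrier → Carrier
  eval []      y = 0#
  eval (a ∷ p) y = a * y ^ length p + eval p y

  ⟦⟧≈eval : ∀ p y → ⟦ p ⟧ y ≈ eval (map ιℤ p) y
  ⟦⟧≈eval []      y = refl
  ⟦⟧≈eval (a ∷ p) y = +-cong (*-congˡ (^-congʳ y (≡.sym (length-map ιℤ p)))) (⟦⟧≈eval p y)

  -- synthetic division of acc * x ^ length p + eval p x by x - c: (quotient , value at c)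
  synthetic : Carrier → Carrier → List Carrier → List Carrier × Carrier
  synthetic c acc []      = [] , acc
  synthetic c acc (a ∷ p) = acc ∷ proj₁ (synthetic c (acc * c + a) p) , proj₂ (synthetic c (acc * c + a) p)

  linearQuotient : Carrier → List Carrier → List Carrier
  linearQuotient c []      = []
  linearQuotient c (a ∷ p) = proj₁ (synthetic c a p)

  private
    length-synthetic : ∀ c acc p → length (proj₁ (synthetic c acc p)) ≡ length p
    length-synthetic c acc []      = ≡.refl
    length-synthetic c acc (a ∷ p) = ≡.cong suc (length-synthetic c (acc * c + a) p)

    synthetic-correct : ∀ c acc p y → acc * y ^ length p + eval p y ≈
                        (y - c) * eval (proj₁ (synthetic c acc p)) y + proj₂ (synthetic c acc p)
    synthetic-correct c acc []      y = trans (+-identityʳ _) (trans (*-identityʳ _) (sym (trans (+-congʳ (zeroʳ _)) (+-identityˡ _))))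
    synthetic-correct c acc (a ∷ p) y = begin
      acc * (y * y ^ length p) + (a * y ^ length p + eval p y)
        ≈⟨ solve 6 (λ acc u y c a e → acc :* (y :* u) :+ (a :* u :+ e) := (y :- c) :* (acc :* u) :+ ((acc :* c :+ a) :* u :+ e))
                  refl acc (y ^ length p) y c a (eval p y) ⟩
      (y - c) * (acc * y ^ length p) + ((acc * c + a) * y ^ length p + eval p y)
        ≈⟨ +-congˡ (synthetic-correct c (acc * c + a) p y) ⟩
      (y - c) * (acc * y ^ length p) + ((y - c) * eval q y + r)
        ≈⟨ solve 4 (λ d u v r → d :* u :+ (d :* v :+ r) := d :* (u :+ v) :+ r) refl (y - c) (acc * y ^ length p) (eval q y) r ⟩
      (y - c) * (acc * y ^ length p + eval q y) + r
        ≈⟨ +-congʳ (*-congˡ (+-congʳ (*-congˡ (^-congʳ y (≡.sym (length-synthetic c (acc * c + a) p)))))) ⟩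
      (y - c) * (acc * y ^ length q + eval q y) + r ∎
      where
      q = proj₁ (synthetic c (acc * c + a) p)
      r = proj₂ (synthetic c (acc * c + a) p)

  length-linearQuotient : ∀ c a p → length (linearQuotient c (a ∷ p)) ≡ length p
  length-linearQuotient c a p = length-synthetic c a p

  factor-theorem : ∀ c p y → eval p y ≈ (y - c) * eval (linearQuotient c p) y + eval p c
  factor-theorem c []      y = sym (trans (+-identityʳ _) (zeroʳ _))
  factor-theorem c (a ∷ p) y = trans (synthetic-correct c a p y) (+-congˡ (sym value-at-c))
    where
    value-at-c : eval (a ∷ p) c ≈ proj₂ (synthetic c a p)
    value-at-c = trans (synthetic-correct c a p c) (trans (+-congʳ (trans (*-congʳ (-‿inverseʳ c)) (zeroˡ _))) (+-identityˡ _))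

  Distinct : List Carrier → Set (c ⊔ ℓ)
  Distinct = AllPairs (λ a b → ¬ a ≈ b)

  Roots : List Carrier → List Carrier → Set (c ⊔ ℓ)
  Roots p = All (λ c → eval p c ≈ 0#)

  x-y≈0⇒x≈y : ∀ {x y} → x - y ≈ 0# → x ≈ y
  x-y≈0⇒x≈y {x} {y} x-y≈0 = begin
    x              ≈⟨ +-identityʳ x ⟨
    x + 0#         ≈⟨ +-congˡ (-‿inverseˡ y) ⟨
    x + (- y + y)  ≈⟨ +-assoc _ _ _ ⟨
    (x - y) + y    ≈⟨ +-congʳ x-y≈0 ⟩
    0# + y         ≈⟨ +-identityˡ y ⟩
    y              ∎

  private
    linearQuotient-roots : ∀ c p {cs} → All (λ c′ → ¬ c ≈ c′) cs → eval p c ≈ 0# → Roots p cs → Roots (linearQuotient c p) cs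
    linearQuotient-roots c p []             _      []             = []
    linearQuotient-roots c p (c≉c′ ∷ c≉cs) p[c]≈0 (p[c′]≈0 ∷ rs) = root ∷ linearQuotient-roots c p c≉cs p[c]≈0 rs
      where
      c′ = _
      product≈0 : (c′ - c) * eval (linearQuotient c p) c′ ≈ 0#
      product≈0 = begin
        (c′ - c) * eval (linearQuotient c p) c′              ≈⟨ +-identityʳ _ ⟨
        (c′ - c) * eval (linearQuotient c p) c′ + 0#         ≈⟨ +-congˡ p[c]≈0 ⟨
        (c′ - c) * eval (linearQuotient c p) c′ + eval p c   ≈⟨ factor-theorem c p c′ ⟨
        eval p c′                                      ≈⟨ p[c′]≈0 ⟩
        0#                                             ∎
      root : eval (linearQuotient c p) c′ ≈ 0#
      root with domain _ _ product≈0
      ... | inj₁ c′-c≈0 = ⊥-elim (c≉c′ (sym (x-y≈0⇒x≈y c′-c≈0)))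
      ... | inj₂ q[c′]≈0 = q[c′]≈0

  roots⇒zero : ∀ p cs → length p ≤ length cs → Distinct cs → Roots p cs → ∀ y → eval p y ≈ 0#
  roots⇒zero []      cs       _         _            _               y = refl
  roots⇒zero (a ∷ p) (c ∷ cs) (s≤s p≤cs) (c≉cs ∷ cs≉) (p[c]≈0 ∷ rs) y = begin
    eval (a ∷ p) y                                ≈⟨ factor-theorem c (a ∷ p) y ⟩
    (y - c) * eval (linearQuotient c (a ∷ p)) y + eval (a ∷ p) c
      ≈⟨ +-cong (*-congˡ (roots⇒zero (linearQuotient c (a ∷ p)) cs (ℕP.≤-trans (ℕP.≤-reflexive (length-linearQuotient c a p)) p≤cs) cs≉
                            (linearQuotient-roots c (a ∷ p) c≉cs p[c]≈0 rs) y)) p[c]≈0 ⟩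
    (y - c) * 0# + 0#                             ≈⟨ trans (+-identityʳ _) (zeroʳ _) ⟩
    0#                                            ∎

  -- the head h of the monic polynomial is kept as a variable: linearQuotient c (h ∷ a ∷ p) reduces to h ∷ _
  roots⇒product : ∀ h p cs → h ≈ 1# → length p ≡ length cs → Distinct cs → Roots (h ∷ p) cs →
                  ∀ y → eval (h ∷ p) y ≈ prod (map (λ c → y - c) cs)
  roots⇒product h []      []       h≈1 _   _            _              y = trans (+-identityʳ _) (trans (*-identityʳ _) h≈1)
  roots⇒product h (a ∷ p) (c ∷ cs) h≈1 len (c≉cs ∷ cs≉) (p[c]≈0 ∷ rs) y = begin
    eval (h ∷ a ∷ p) y                                        ≈⟨ factor-theorem c (h ∷ a ∷ p) y ⟩
    (y - c) * eval (linearQuotient c (h ∷ a ∷ p)) y + eval (h ∷ a ∷ p) c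
      ≈⟨ +-cong (*-congˡ (roots⇒product h (linearQuotient c ((h * c + a) ∷ p)) cs h≈1
                            (≡.trans (length-linearQuotient c (h * c + a) p) (ℕP.suc-injective len)) cs≉
                            (linearQuotient-roots c (h ∷ a ∷ p) c≉cs p[c]≈0 rs) y)) p[c]≈0 ⟩
    (y - c) * prod (map (λ c → y - c) cs) + 0#                       ≈⟨ +-identityʳ _ ⟩
    (y - c) * prod (map (λ c → y - c) cs)                            ∎

  x*y≈0∧y≉0⇒x≈0 : ∀ {x y} → x * y ≈ 0# → ¬ y ≈ 0# → x ≈ 0#
  x*y≈0∧y≉0⇒x≈0 xy≈0 y≉0 with domain _ _ xy≈0
  ... | inj₁ x≈0 = x≈0
  ... | inj₂ y≈0 = ⊥-elim (y≉0 y≈0)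

  prod-nonzero : ∀ {a} {A : Set a} (f : A → Carrier) xs → (∀ {x} → x ∈ xs → ¬ f x ≈ 0#) → ¬ prod (map f xs) ≈ 0#
  prod-nonzero f []       _      = 1≉0
  prod-nonzero f (x ∷ xs) f≉0 ≈0 with domain _ _ ≈0
  ... | inj₁ fx≈0 = f≉0 (here ≡.refl) fx≈0
  ... | inj₂ ≈0′  = prod-nonzero f xs (λ x∈ → f≉0 (there x∈)) ≈0′

  open import Algebra.Properties.Semiring.Exp semiring using (^-congˡ; ^-homo-*; ^-assocʳ)
  open import Algebra.Properties.Ring ring using (-‿distribʳ-*)

  ^-nonzero : ∀ {x} → ¬ x ≈ 0# → ∀ k → ¬ x ^ k ≈ 0#
  ^-nonzero x≉0 zero    = 1≉0
  ^-nonzero x≉0 (suc k) x^k+1≈0 with domain _ _ x^k+1≈0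
  ... | inj₁ x≈0   = x≉0 x≈0
  ... | inj₂ x^k≈0 = ^-nonzero x≉0 k x^k≈0

  ExactOrder⇒nonzero : ∀ {ζ} n → ExactOrder ζ n → ¬ ζ ≈ 0#
  ExactOrder⇒nonzero (suc n) (_ , ζ^n≈1 , _) ζ≈0 = 1≉0 (trans (sym ζ^n≈1) (trans (*-congʳ ζ≈0) (zeroˡ _)))

  module _ {ζ : Carrier} {n : ℕ} (order : ExactOrder ζ n) where

    private
      ζ^n≈1 : ζ ^ n ≈ 1#
      ζ^n≈1 = proj₁ (proj₂ order)

      ζ≉0 : ¬ ζ ≈ 0#
      ζ≉0 = ExactOrder⇒nonzero n order

      ^-< : ∀ {i j} → i < j → j < n → ¬ ζ ^ i ≈ ζ ^ j
      ^-< {i} {j} i<j j<n ζ^i≈ζ^j with domain (ζ ^ i) (ζ ^ (j ∸ i) - 1#) product≈0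
        where
        product≈0 : ζ ^ i * (ζ ^ (j ∸ i) - 1#) ≈ 0#
        product≈0 = begin
          ζ ^ i * (ζ ^ (j ∸ i) - 1#)          ≈⟨ distribˡ _ _ _ ⟩
          ζ ^ i * ζ ^ (j ∸ i) + ζ ^ i * - 1#  ≈⟨ +-cong (sym (trans (^-congʳ ζ (≡.sym (ℕP.m+[n∸m]≡n (ℕP.<⇒≤ i<j)))) (^-homo-* ζ i (j ∸ i)))) (sym (-‿distribʳ-* _ _)) ⟩
          ζ ^ j + - (ζ ^ i * 1#)               ≈⟨ +-cong (sym ζ^i≈ζ^j) (-‿cong (*-identityʳ _)) ⟩
          ζ ^ i - ζ ^ i                        ≈⟨ -‿inverseʳ _ ⟩
          0#                                   ∎
      ... | inj₁ ζ^i≈0     = ^-nonzero ζ≉0 i ζ^i≈0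
      ... | inj₂ ζ^[j-i]-1≈0 = proj₂ (proj₂ order) (j ∸ i) (ℕP.m<n⇒0<n∸m i<j)
                                  (ℕP.≤-trans (s≤s (ℕP.m∸n≤m j i)) j<n) (x-y≈0⇒x≈y ζ^[j-i]-1≈0)

    ^-injective : ∀ {i j} → i < n → j < n → ζ ^ i ≈ ζ ^ j → i ≡ j
    ^-injective {i} {j} i<n j<n ζ^i≈ζ^j with ℕP.<-cmp i j
    ... | tri≈ _ i≡j _ = i≡j
    ... | tri< i<j _ _ = ⊥-elim (^-< i<j j<n ζ^i≈ζ^j)
    ... | tri> _ _ j<i = ⊥-elim (^-< j<i i<n (sym ζ^i≈ζ^j))

    powers-distinct : ∀ {xs} → Unique xs → (∀ {x} → x ∈ xs → x < n) → Distinct (map (ζ ^_) xs)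
    powers-distinct xs! xs<n = AllPairs.map⁺ (unique⇒allPairs xs! (λ x∈ y∈ x≢y → x≢y ∘ ^-injective (xs<n x∈) (xs<n y∈)))

    ^-root : ∀ l → (ζ ^ l) ^ n ≈ 1#
    ^-root l = begin
      (ζ ^ l) ^ n      ≈⟨ ^-assocʳ ζ l n ⟩
      ζ ^ (l ℕ.* n)    ≡⟨ ≡.cong (ζ ^_) (ℕP.*-comm l n) ⟩
      ζ ^ (n ℕ.* l)    ≈⟨ ^-assocʳ ζ n l ⟨
      (ζ ^ n) ^ l      ≈⟨ ^-congˡ l ζ^n≈1 ⟩
      1# ^ l           ≈⟨ 1^ l ⟩
      1#               ∎
      where
      1^ : ∀ k → 1# ^ k ≈ 1#
      1^ zero    = refl
      1^ (suc k) = trans (*-identityˡ _) (1^ k)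

    ^-% : ∀ x .{{_ : ℕ.NonZero n}} → ζ ^ (x % n) ≈ ζ ^ x
    ^-% x = begin
      ζ ^ (x % n)                          ≈⟨ *-identityʳ _ ⟨
      ζ ^ (x % n) * 1#                     ≈⟨ *-congˡ (^-root (x / n)) ⟨
      ζ ^ (x % n) * (ζ ^ (x / n)) ^ n      ≈⟨ *-congˡ (^-assocʳ ζ (x / n) n) ⟩
      ζ ^ (x % n) * ζ ^ (x / n ℕ.* n)      ≈⟨ ^-homo-* ζ (x % n) _ ⟨
      ζ ^ (x % n ℕ.+ x / n ℕ.* n)          ≡⟨ ≡.cong (ζ ^_) (m≡m%n+[m/n]*n x n) ⟨
      ζ ^ x                                ∎

    ExactOrder-^ : ∀ {e d} → e ℕ.* d ≡ n → 1 ≤ e → ExactOrder (ζ ^ d) e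
    ExactOrder-^ {e} {d} e*d≡n e≥1 = e≥1 , ζ^d^e≈1 , minimal
      where
      d*e≡n = ≡.trans (ℕP.*-comm d e) e*d≡n
      ζ^d^e≈1 : (ζ ^ d) ^ e ≈ 1#
      ζ^d^e≈1 = trans (^-assocʳ ζ d e) (trans (^-congʳ ζ d*e≡n) ζ^n≈1)
      d≥1 : 1 ≤ d
      d≥1 = ℕP.n≢0⇒n>0 (λ d≡0 → ℕP.<⇒≢ (proj₁ order) (≡.sym (≡.trans (≡.sym e*d≡n) (≡.trans (≡.cong (e ℕ.*_) d≡0) (ℕP.*-zeroʳ e)))))
      minimal : ∀ k → 1 ≤ k → k < e → ¬ (ζ ^ d) ^ k ≈ 1#
      minimal k k≥1 k<e ζ^dk≈1 = proj₂ (proj₂ order) (d ℕ.* k) (ℕP.*-mono-≤ d≥1 k≥1)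
        (≡.subst (d ℕ.* k <_) d*e≡n (ℕP.*-monoʳ-< d {{ℕ.>-nonZero d≥1}} k<e))
        (trans (sym (^-assocʳ ζ d k)) ζ^dk≈1)


module Cyclotomic {c ℓ : Level} (R : CommutativeRing c ℓ) (isIntegralDomain : IsIntegralDomain R) where

  open CommutativeRing R

  open import Data.List.Relation.Unary.All using ([]; _∷_)
  open import Data.List.Relation.Unary.AllPairs as AllPairs using ([]; _∷_)

  open InRing R using (ιℤ; prod; ExactOrder)
  open IntegerEmbedding R using (ιℤ-1)
  open Evaluation R
  open Products R
  open Roots R isIntegralDomain
  open import Algebra.Definitions.RawSemiring (Algebra.Bundles.Semiring.rawSemiring semiring) using (_^_)
  open import Algebra.Properties.Semiring.Exp semiring using (^-congʳ; ^-assocʳ)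
  open import Relation.Binary.Reasoning.Setoid setoid

  record Splits (p : Polyℤ) (ζ : Carrier) (xs : List ℕ) : Set (c ⊔ ℓ) where
    field
      lower      : List ℤ
      monic      : p ≡ + 1 ∷ lower
      degree     : length lower ≡ length xs
      ⟦⟧-product : ∀ y → ⟦ p ⟧ y ≈ prod (map (λ a → y - ζ ^ a) xs)

  Splits-*ₚ : ∀ {p q ζ xs ys} → Splits p ζ xs → Splits q ζ ys → Splits (p *ₚ q) ζ (xs ++ ys)
  Splits-*ₚ {p} {q} {ζ} {xs} {ys} p-splits q-splits = record
    { lower = proj₁ monic-product
    ; monic = ≡.trans (≡.cong₂ _*ₚ_ P.monic Q.monic) (proj₁ (proj₂ monic-product))
    ; degree = ≡.trans (proj₂ (proj₂ monic-product)) (≡.trans (≡.cong₂ ℕ._+_ P.degree Q.degree) (≡.sym (length-++ xs)))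
    ; ⟦⟧-product = λ y → begin
        ⟦ p *ₚ q ⟧ y                 ≈⟨ ⟦⟧-*ₚ p q y ⟩
        ⟦ p ⟧ y * ⟦ q ⟧ y             ≈⟨ *-cong (P.⟦⟧-product y) (Q.⟦⟧-product y) ⟩
        prod (map (λ a → y - ζ ^ a) xs) * prod (map (λ a → y - ζ ^ a) ys) ≈⟨ prod-++ (map _ xs) (map _ ys) ⟨
        prod (map (λ a → y - ζ ^ a) xs ++ map (λ a → y - ζ ^ a) ys)        ≡⟨ ≡.cong prod (map-++ _ xs ys) ⟨
        prod (map (λ a → y - ζ ^ a) (xs ++ ys))                            ∎
    }
    where
    module P = Splits p-splits
    module Q = Splits q-splits
    monic-product = *ₚ-monic P.lower Q.lower

  Splits-prodₚ : ∀ {ζ} (F : ℕ → Polyℤ) (g : ℕ → List ℕ) es → All (λ e → Splits (F e) ζ (g e)) es →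
                 Splits (prodₚ (map F es)) ζ (concatMap g es)
  Splits-prodₚ F g []       []       = record
    { lower = [] ; monic = ≡.refl ; degree = ≡.refl ; ⟦⟧-product = λ y → trans (+-identityʳ _) (trans (*-identityʳ _) ιℤ-1) }
  Splits-prodₚ F g (e ∷ es) (s ∷ ss) = Splits-*ₚ s (Splits-prodₚ F g es ss)

  Splits-^ : ∀ {p ζ d xs} → Splits p (ζ ^ d) xs → Splits p ζ (map (ℕ._* d) xs)
  Splits-^ {p} {ζ} {d} {xs} p-splits = record
    { lower = lower ; monic = monic ; degree = ≡.trans degree (≡.sym (length-map _ xs))
    ; ⟦⟧-product = λ y → begin
        ⟦ p ⟧ y                                          ≈⟨ ⟦⟧-product y ⟩
        prod (map (λ a → y - (ζ ^ d) ^ a) xs)            ≈⟨ prod-map-cong xs (λ {a} _ → +-congˡ (-‿cong (trans (^-assocʳ ζ d a) (^-congʳ ζ (ℕP.*-comm d a))))) ⟩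
        prod (map (λ a → y - ζ ^ (a ℕ.* d)) xs)          ≡⟨ ≡.cong prod (map-∘ xs) ⟩
        prod (map (λ b → y - ζ ^ b) (map (ℕ._* d) xs))   ∎
    }
    where open Splits p-splits

  module _ {ζ n} (order : ExactOrder ζ n) {xs} (xs! : Unique xs) (xs<n : ∀ {x} → x ∈ xs → x < n) where

    roots-of-unity⇒zero : ∀ p → length p ≤ length xs → (∀ {a} → a ∈ xs → ⟦ p ⟧ (ζ ^ a) ≈ 0#) → ∀ y → ⟦ p ⟧ y ≈ 0#
    roots-of-unity⇒zero p p≤xs p[ζ^a]≈0 y = trans (⟦⟧≈eval p y)
      (roots⇒zero (map ιℤ p) (map (ζ ^_) xs)
        (≡.subst₂ _≤_ (≡.sym (length-map ιℤ p)) (≡.sym (length-map _ xs)) p≤xs)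
        (powers-distinct order xs! xs<n)
        (All.map⁺ (All.tabulate (λ {a} a∈ → trans (sym (⟦⟧≈eval p (ζ ^ a))) (p[ζ^a]≈0 a∈))))
        y)

    roots-of-unity⇒Splits : ∀ {p} lower → p ≡ + 1 ∷ lower → length lower ≡ length xs →
                            (∀ {a} → a ∈ xs → ⟦ p ⟧ (ζ ^ a) ≈ 0#) → Splits p ζ xs
    roots-of-unity⇒Splits {p} lower monic degree p[ζ^a]≈0 = record
      { lower = lower ; monic = monic ; degree = degree
      ; ⟦⟧-product = λ y → begin
          ⟦ p ⟧ y                                  ≡⟨ ≡.cong (λ u → ⟦ u ⟧ y) monic ⟩
          ⟦ + 1 ∷ lower ⟧ y                        ≈⟨ ⟦⟧≈eval (+ 1 ∷ lower) y ⟩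
          eval (map ιℤ (+ 1 ∷ lower)) y
            ≈⟨ roots⇒product (ιℤ (+ 1)) (map ιℤ lower) (map (ζ ^_) xs) ιℤ-1
                 (≡.trans (length-map ιℤ lower) (≡.trans degree (≡.sym (length-map _ xs))))
                 (powers-distinct order xs! xs<n)
                 (All.map⁺ (All.tabulate (λ {a} a∈ → begin
                   eval (map ιℤ (+ 1 ∷ lower)) (ζ ^ a)  ≈⟨ ⟦⟧≈eval (+ 1 ∷ lower) (ζ ^ a) ⟨
                   ⟦ + 1 ∷ lower ⟧ (ζ ^ a)              ≡⟨ ≡.cong (λ u → ⟦ u ⟧ (ζ ^ a)) monic ⟨
                   ⟦ p ⟧ (ζ ^ a)                        ≈⟨ p[ζ^a]≈0 a∈ ⟩
                   0#                                   ∎)))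
                 y ⟩
          prod (map (λ c → y - c) (map (ζ ^_) xs)) ≡⟨ ≡.cong prod (map-∘ xs) ⟨
          prod (map (λ a → y - ζ ^ a) xs)          ∎
      }

  quotient-splits : ∀ {ζ n d} → ExactOrder ζ n → Splits d ζ (nonUnits n) → Splits (divMonic (xⁿ-1 n) d) ζ (units n)
  quotient-splits {ζ} {suc n′} {d} order d-splits =
    roots-of-unity⇒Splits order (units-unique n) (proj₁ ∘ ∈units⁻ n) q′ (≡.trans (≡.cong (divMonic X) monic) (proj₂ q-head)) length-q′ q-root
    where
    open Splits d-splits
    n = suc n′
    X = xⁿ-1 n
    tail = length (replicate n′ (+ 0) ++ ℤ.- (+ 1) ∷ [])
    tail≡n : tail ≡ n
    tail≡n = ≡.trans (length-++ (replicate n′ (+ 0))) (≡.trans (≡.cong (ℕ._+ 1) (length-replicate n′)) (ℕP.+-comm n′ 1))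
    ds≤tail : length lower ≤ tail
    ds≤tail = ℕP.≤-trans (ℕP.≤-reflexive degree)
                (ℕP.≤-trans (ℕP.m≤m+n _ (length (units n))) (ℕP.≤-reflexive (≡.trans (length-nonUnits+units n) (≡.sym tail≡n))))
    q = divMonic X (+ 1 ∷ lower)
    q-head = divMonic-fuel-head tail (+ 1) _ (+ 1) lower ds≤tail
    q′ = proj₁ q-head
    open DivisionWithRemainder (divMonic-fuel-division (length X) X lower (ℕP.m∸n≤m (length X) (length lower)))
    length-q′ : length q′ ≡ length (units n)
    length-q′ = ℕP.suc-injective (≡.trans (≡.cong length (≡.sym (proj₂ q-head)))
                  (≡.trans length-quotient (≡.trans (ℕP.+-∸-assoc 1 ds≤tail) (≡.cong suc tail∸ds≡units))))
      where
      tail∸ds≡units : tail ∸ length lower ≡ length (units n)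
      tail∸ds≡units = ≡.trans (≡.cong₂ _∸_ (≡.trans tail≡n (≡.sym (length-nonUnits+units n))) degree)
                              (ℕP.m+n∸m≡n (length (nonUnits n)) (length (units n)))
    X-root : ∀ l → ⟦ X ⟧ (ζ ^ l) ≈ 0#
    X-root l = trans (⟦xⁿ-1⟧ n′ (ζ ^ l)) (trans (+-congʳ (^-root order l)) (-‿inverseʳ 1#))
    d[ζ^l]≈0 : ∀ {l} → l ∈ nonUnits n → ⟦ + 1 ∷ lower ⟧ (ζ ^ l) ≈ 0#
    d[ζ^l]≈0 {l} l∈ = trans (reflexive (≡.cong (λ u → ⟦ u ⟧ (ζ ^ l)) (≡.sym monic)))
                        (trans (⟦⟧-product (ζ ^ l)) (prod-zero (λ l′ → ζ ^ l - ζ ^ l′) (nonUnits n) l∈ (-‿inverseʳ _)))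
    -- the remainder has fewer than length (nonUnits n) coefficients, yet vanishes at every ζ ^ l, l ∈ nonUnits n
    exact : ∀ y → ⟦ X ⟧ y ≈ ⟦ q ⟧ y * ⟦ + 1 ∷ lower ⟧ y
    exact y = trans (identity y) (trans (+-congˡ (remainder≈0 y)) (+-identityʳ _))
      where
      remainder≈0 = roots-of-unity⇒zero order (nonUnits-unique n) (proj₁ ∘ ∈nonUnits⁻ n) remainder
        (ℕP.≤-trans length-remainder (ℕP.≤-reflexive degree))
        (λ {l} l∈ → begin
          ⟦ remainder ⟧ (ζ ^ l)                                         ≈⟨ +-identityˡ _ ⟨
          0# + ⟦ remainder ⟧ (ζ ^ l)                                     ≈⟨ +-congʳ (trans (*-congˡ (d[ζ^l]≈0 l∈)) (zeroʳ _)) ⟨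
          ⟦ q ⟧ (ζ ^ l) * ⟦ + 1 ∷ lower ⟧ (ζ ^ l) + ⟦ remainder ⟧ (ζ ^ l) ≈⟨ identity (ζ ^ l) ⟨
          ⟦ X ⟧ (ζ ^ l)                                                 ≈⟨ X-root l ⟩
          0#                                                            ∎)
    q-root : ∀ {a} → a ∈ units n → ⟦ divMonic X d ⟧ (ζ ^ a) ≈ 0#
    q-root {a} a∈ = trans (reflexive (≡.cong (λ u → ⟦ divMonic X u ⟧ (ζ ^ a)) monic))
                      (x*y≈0∧y≉0⇒x≈0 (trans (sym (exact (ζ ^ a))) (X-root a)) d[ζ^a]≉0)
      where
      ζ^a≉ζ^l : ∀ {l} → l ∈ nonUnits n → ¬ ζ ^ a - ζ ^ l ≈ 0#
      ζ^a≉ζ^l {l} l∈ ζ^a-ζ^l≈0 = proj₂ (∈nonUnits⁻ n l∈) (≡.subst (λ b → Coprime b n)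
        (^-injective order (proj₁ (∈units⁻ n a∈)) (proj₁ (∈nonUnits⁻ n l∈)) (x-y≈0⇒x≈y ζ^a-ζ^l≈0)) (proj₂ (∈units⁻ n a∈)))
      d[ζ^a]≉0 : ¬ ⟦ + 1 ∷ lower ⟧ (ζ ^ a) ≈ 0#
      d[ζ^a]≉0 d[ζ^a]≈0 = prod-nonzero (λ l → ζ ^ a - ζ ^ l) (nonUnits n) ζ^a≉ζ^l
        (trans (sym (⟦⟧-product (ζ ^ a))) (trans (reflexive (≡.cong (λ u → ⟦ u ⟧ (ζ ^ a)) monic)) d[ζ^a]≈0))

  cyclotomic-fuel-splits : ∀ f n → 1 ≤ n → n ≤ f → ∀ {ζ} → ExactOrder ζ n → Splits (Φ-fuel f n) ζ (units n)
  cyclotomic-fuel-splits zero    (suc n) _   ()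
  cyclotomic-fuel-splits (suc f) n       n≥1 n≤f {ζ} order = quotient-splits order
    (Splits-prodₚ (Φ-fuel f) (λ e → map (ℕ._* cofactor n e) (units e)) (properDivisors n)
      (All.tabulate divisor-splits))
    where
    divisor-splits : ∀ {e} → e ∈ properDivisors n → Splits (Φ-fuel f e) ζ (map (ℕ._* cofactor n e) (units e))
    divisor-splits {e} e∈ =
      Splits-^ (cyclotomic-fuel-splits f e positive (ℕP.≤-pred (ℕP.≤-trans <n n≤f)) (ExactOrder-^ order *-cofactor positive))
      where open ProperDivisor (∈properDivisors⁻ n e∈)

  cyclotomic-splits : ∀ {ζ n} → ExactOrder ζ n → Splits (cyclotomic n) ζ (units n)
  cyclotomic-splits {n = n} order = cyclotomic-fuel-splits n n (proj₁ order) ℕP.≤-refl order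


module ThueMorseProduct {c ℓ : Level} (R : CommutativeRing c ℓ) where

  open CommutativeRing R
  open InRing R using (ιℤ; T; prod)
  open IntegerEmbedding R
  open ℤ-Solver using (solve; _:=_; _:+_; _:*_; _:-_; :-_)
  open import Algebra.Definitions.RawSemiring (Algebra.Bundles.Semiring.rawSemiring semiring) using (_^_)
  open import Algebra.Properties.Semiring.Exp semiring using (^-congˡ; ^-congʳ)
  open Products R using (prod-applyUpTo-cong)
  open import Relation.Binary.Reasoning.Setoid setoid

  T-cong : ∀ n {x y} → x ≈ y → T n x ≈ T n y
  T-cong zero    x≈y = refl
  T-cong (suc n) x≈y = +-cong (T-cong n x≈y) (*-congˡ (^-congˡ n x≈y))

  private
    ^-double : ∀ n x → x ^ (n ℕ.* 2) ≈ (x * x) ^ n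
    ^-double zero    x = refl
    ^-double (suc n) x = trans (sym (*-assoc x x _)) (*-congˡ (^-double n x))

  T-double : ∀ n x → T (n ℕ.* 2) x ≈ T n (x * x) * (1# - x)
  T-double zero    x = sym (zeroˡ _)
  T-double (suc n) x = begin
    (T (n ℕ.* 2) x + ιℤ (t (n ℕ.* 2)) * x ^ (n ℕ.* 2)) + ιℤ (t (suc (n ℕ.* 2))) * (x * x ^ (n ℕ.* 2))
      ≈⟨ +-cong (+-cong (T-double n x) (*-cong (reflexive (≡.cong ιℤ (t-double n))) (^-double n x)))
                (*-cong (trans (reflexive (≡.cong ιℤ (t-double+1 n))) (ιℤ-neg (t n))) (*-congˡ (^-double n x))) ⟩
    (T n (x * x) * (1# - x) + ιℤ (t n) * (x * x) ^ n) + - ιℤ (t n) * (x * (x * x) ^ n)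
      ≈⟨ +-congʳ (+-congˡ (*-congˡ (sym (*-identityʳ _)))) ⟩
    (T n (x * x) * (1# - x) + ιℤ (t n) * ((x * x) ^ n * 1#)) + - ιℤ (t n) * (x * (x * x) ^ n)
      ≈⟨ solve 5 (λ A τ P x o → (A :* (o :- x) :+ τ :* (P :* o)) :+ (:- τ) :* (x :* P) := (A :+ τ :* P) :* (o :- x))
                refl (T n (x * x)) (ιℤ (t n)) ((x * x) ^ n) x 1# ⟩
    (T n (x * x) + ιℤ (t n) * (x * x) ^ n) * (1# - x) ∎

  T-2^s : ∀ s x → T (2 ℕ.^ s) x ≈ prod (applyUpTo (λ k → 1# - x ^ (2 ℕ.^ k)) s)
  T-2^s zero    x = trans (+-identityˡ _) (trans (*-identityʳ _) ιℤ-1)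
  T-2^s (suc s) x = begin
    T (2 ℕ.^ suc s) x                                           ≡⟨ ≡.cong (λ n → T n x) (ℕP.*-comm 2 (2 ℕ.^ s)) ⟩
    T (2 ℕ.^ s ℕ.* 2) x                                         ≈⟨ T-double (2 ℕ.^ s) x ⟩
    T (2 ℕ.^ s) (x * x) * (1# - x)                              ≈⟨ *-congʳ (T-2^s s (x * x)) ⟩
    prod (applyUpTo (λ k → 1# - (x * x) ^ (2 ℕ.^ k)) s) * (1# - x) ≈⟨ *-comm _ _ ⟩
    (1# - x) * prod (applyUpTo (λ k → 1# - (x * x) ^ (2 ℕ.^ k)) s)
      ≈⟨ *-cong (+-congˡ (-‿cong (sym (*-identityʳ x)))) (prod-applyUpTo-cong s (λ k → +-congˡ (-‿cong (sym (x^2^[k+1] k))))) ⟩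
    (1# - x ^ 1) * prod (applyUpTo (λ k → 1# - x ^ (2 ℕ.^ suc k)) s) ∎
    where
    x^2^[k+1] : ∀ k → x ^ (2 ℕ.^ suc k) ≈ (x * x) ^ (2 ℕ.^ k)
    x^2^[k+1] k = trans (^-congʳ x (ℕP.*-comm 2 (2 ℕ.^ k))) (^-double (2 ℕ.^ k) x)

open import Data.Nat using (ℕ; _^_)
open import Data.Nat.Properties using ()
open import Data.Integer using (+_)
open import Data.List using (List; _∷_; map)
open import Data.Product using (_×_)
open import Algebra.Bundles using (CommutativeRing)

lemma8p1 : {c ℓ : Level} (R : CommutativeRing c ℓ) → InRing.IsCharZeroDomain R →
    (ω : CommutativeRing.Carrier R) (r₀ : ℕ) → InRing.ExactOrder R ω r₀ → Odd r₀ →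
    (s₀ : ℕ) → IsOrderOf2Mod r₀ s₀ →
    (ms : List ℕ) → CosetReps r₀ (1 ∷ ms) →
    let open CommutativeRing R
        open InRing R
    in ιℤ (evalℤ (cyclotomic r₀) (+ 1))
         ≈ T (2 ^ s₀) ω * prod (map (λ m → T (2 ^ s₀) (ωpow ω m)) ms)
lemma8p1 R (1≉0 , domain , _) ω r₀ order _ s₀ s₀-order ms reps = begin
  ιℤ (evalℤ (cyclotomic r₀) (+ 1))                           ≈⟨ trans (ιℤ-evalℤ (cyclotomic r₀) (+ 1)) (⟦⟧-cong (cyclotomic r₀) ιℤ-1) ⟩
  ⟦ cyclotomic r₀ ⟧ 1#                                        ≈⟨ Splits.⟦⟧-product (cyclotomic-splits order) 1# ⟩
  prod (map (λ a → 1# - ωpow ω a) (units r₀))                 ≈⟨ prod-↭ (λ a → 1# - ωpow ω a) cosetEnumeration↭units ⟨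
  prod (map (λ a → 1# - ωpow ω a) (concatMap orbit (1 ∷ ms))) ≈⟨ prod-concatMap (λ a → 1# - ωpow ω a) orbit (1 ∷ ms) ⟩
  prod (map (λ m → prod (map (λ a → 1# - ωpow ω a) (orbit m))) (1 ∷ ms))  ≈⟨ prod-map-cong (1 ∷ ms) (λ {m} _ → orbit-product m) ⟩
  T (2 ^ s₀) (ωpow ω 1) * prod (map (λ m → T (2 ^ s₀) (ωpow ω m)) ms)     ≈⟨ *-congʳ (T-cong (2 ^ s₀) (*-identityʳ ω)) ⟩
  T (2 ^ s₀) ω * prod (map (λ m → T (2 ^ s₀) (ωpow ω m)) ms)              ∎
  where
  open CommutativeRing R
  open InRing R using (ιℤ; T; prod; ωpow)
  open import Algebra.Properties.Semiring.Exp semiring using (^-assocʳ)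
  open import Relation.Binary.Reasoning.Setoid setoid
  open IntegerEmbedding R using (ιℤ-1)
  open Evaluation R using (⟦_⟧; ιℤ-evalℤ; ⟦⟧-cong)
  open Products R using (prod-↭; prod-concatMap; prod-map-cong; prod-applyUpTo-cong)
  open Roots R (1≉0 , domain) using (^-%)
  open Cyclotomic R (1≉0 , domain) using (module Splits; cyclotomic-splits)
  open ThueMorseProduct R using (T-cong; T-2^s)
  instance r₀-nonZero : ℕ.NonZero r₀
  r₀-nonZero = ℕ.>-nonZero (proj₁ order)
  open CosetEnumeration r₀ s₀ s₀-order (1 ∷ ms) reps using (orbit; cosetEnumeration↭units)
  orbit-product : ∀ m → prod (map (λ a → 1# - ωpow ω a) (orbit m)) ≈ T (2 ^ s₀) (ωpow ω m)
  orbit-product m = begin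
    prod (map (λ a → 1# - ωpow ω a) (orbit m))                  ≡⟨ ≡.cong prod (map-applyUpTo _ _ s₀) ⟩
    prod (applyUpTo (λ k → 1# - ωpow ω ((m ℕ.* 2 ^ k) % r₀)) s₀) ≈⟨ prod-applyUpTo-cong s₀ (λ k → +-congˡ (-‿cong (trans (^-% order _) (sym (^-assocʳ ω m _))))) ⟩
    prod (applyUpTo (λ k → 1# - ωpow (ωpow ω m) (2 ^ k)) s₀)      ≈⟨ T-2^s s₀ (ωpow ω m) ⟨
    T (2 ^ s₀) (ωpow ω m)                                         ∎
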